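{- For $L$ and $M$ being non-negative integers, we have \begin{align*} \sum_{\substack{m\geq 0\\L\equiv m\ \text{(mod }2\text{)}}} q^{m^2 \mp m}{3M \brack m}_{q^2} {2M + \frac{L-m}{2}\brack 2M}_{q^6} &= \sum_{j=-\infty}^{\infty} q^{3j^2+j}\, \mathcal{T}_{\pm 1}\left(L,M;\,j,j;\,q^6\right). \end{align*}
   Context: Here $|q|<1$, $(a;q)_n=(1-a)(1-aq)\cdots(1-aq^{n-1})$, and ${m+n \brack m}_q = \frac{(q;q)_{m+n}}{(q;q)_m(q;q)_n}$ for $m,n\geq 0$ and $0$ otherwise. Define \[\mathcal{T}_{1}(L,M;\,a,b;\,q) := \sum_{\substack{n\geq0, \\ L-a\equiv n \text{ (mod 2)}}} q^{n\choose 2} {M\brack n}_q {M+b+\frac{L-a-n}{2} \brack M+b}_q {M-b +\frac{L+a-n}{2}\brack M-b}_q,\] \[\mathcal{T}_{ -1}(L,M;\,a,b;\,q) := \sum_{\substack{n\geq0, \\ L-a\equiv n \text{ (mod 2)}}} q^{n+1\choose 2} {M\brack n}_q {M+b+\frac{L-a-n}{2} \brack M+b}_q {M-b +\frac{L+a-n}{2}\brack M-b}_q.\] Upper signs go together ($q^{m^2-m}$ with $\mathcal{T}_1$) and lower signs go together ($q^{m^2+m}$ with $\mathcal{T}_{ -1}$). -}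

module Defs where

open import Level using (Level)
open import Data.Bool using (Bool; true; false; if_then_else_)
open import Data.Nat as ℕ using (ℕ; zero; suc; _∸_; _≤_)
open import Data.Nat.DivMod using (_/_; _%_)
open import Data.Nat.Combinatorics using (_C_)
open import Data.Integer as ℤ using (ℤ; +_; -[1+_]; ∣_∣)
open import Data.Sign using (Sign)
open import Algebra.Bundles using (CommutativeRing)

evenℤ : ℤ → Bool
evenℤ x = ∣ x ∣ % 2 ℕ.≡ᵇ 0

-- Since all sums are finite, an identity holding
-- for every commutative ring and every q is the same as an identity of
-- polynomials in q with integer coefficients.
module Series {c ℓ : Level} (R : CommutativeRing c ℓ) where
  open CommutativeRing R

  pow : Carrier → ℕ → Carrier
  pow x zero    = 1#
  pow x (suc n) = x * pow x n

  sumTo : ℕ → (ℕ → Carrier) → Carrier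
  sumTo zero    f = 0#
  sumTo (suc n) f = sumTo n f + f n

  -- Gaussian binomial coefficient  [n choose k]_q  (as a polynomial in q),
  -- via the q-Pascal rule [n+1,k+1] = [n,k] + q^(k+1) [n,k+1].
  -- (It equals (q;q)_n / ((q;q)_k (q;q)_{n-k}) for k ≤ n, and 0 for k > n.)
  gauss : Carrier → ℕ → ℕ → Carrier
  gauss q zero    zero    = 1#
  gauss q zero    (suc k) = 0#
  gauss q (suc n) zero    = 1#
  gauss q (suc n) (suc k) = gauss q n k + pow q (suc k) * gauss q n (suc k)

  -- The paper's  [m+n brack m]_q  for integers m, n: zero unless m,n ≥ 0.
  brack : Carrier → ℤ → ℤ → Carrier
  brack q (+ m) (+ n)    = gauss q (m ℕ.+ n) m
  brack q (+ m) -[1+ n ] = 0#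
  brack q -[1+ m ] n     = 0#

  -- [m + x/2 brack m]_q for an even integer x (zero if x < 0)
  brackHalf : Carrier → ℤ → ℤ → Carrier
  brackHalf q m (+ x)    = brack q m (+ (x / 2))
  brackHalf q m -[1+ x ] = 0#

  -- Exponent of q in T_σ : (n choose 2) for σ = + (i.e. T_1),
  -- (n+1 choose 2) for σ = - (i.e. T_{-1}).
  tExp : Sign → ℕ → ℕ
  tExp Sign.+ n = n C 2
  tExp Sign.- n = suc n C 2

  -- T_σ(L, M; a, b; q).  The summation over n ≥ 0 is cut at n ≤ M, which
  -- loses nothing since [M brack n] = 0 for n > M.
  T : Sign → ℕ → ℕ → ℤ → ℤ → Carrier → Carrier
  T σ L M a b q = sumTo (suc M) λ n →
    if evenℤ ((+ L) ℤ.- a ℤ.- (+ n))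
    then pow q (tExp σ n)
         * gauss q M n
         * brackHalf q ((+ M) ℤ.+ b) ((+ L) ℤ.- a ℤ.- (+ n))
         * brackHalf q ((+ M) ℤ.- b) ((+ L) ℤ.+ a ℤ.- (+ n))
    else 0#

  lExp : Sign → ℕ → ℕ
  lExp Sign.+ m = m ℕ.* m ∸ m
  lExp Sign.- m = m ℕ.* m ℕ.+ m

  -- LHS: Σ_{m ≥ 0, m ≡ L mod 2} q^{m^2 ∓ m} [3M brack m]_{q^2} [2M + (L-m)/2 brack 2M]_{q^6}.
  -- Cut at m ≤ 3M, which loses nothing since [3M brack m] = 0 for m > 3M.
  LHS : Sign → ℕ → ℕ → Carrier → Carrier
  LHS σ L M q = sumTo (suc (3 ℕ.* M)) λ m →
    if evenℤ ((+ L) ℤ.- (+ m))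
    then pow q (lExp σ m)
         * gauss (pow q 2) (3 ℕ.* M) m
         * brackHalf (pow q 6) (+ (2 ℕ.* M)) ((+ L) ℤ.- (+ m))
    else 0#

  -- Symmetric partial sum of the RHS: Σ_{j = -K}^{K} q^{3j^2+j} T_σ(L,M; j, j; q^6).
  -- (3j^2 + j ≥ 0 for every integer j, so taking ∣_∣ does not change it.)
  RHSpartial : Sign → ℕ → ℕ → ℕ → Carrier → Carrier
  RHSpartial σ L M K q = sumTo (suc (2 ℕ.* K)) λ i →
    let j = (+ i) ℤ.- (+ K) in
    pow q ∣ (+ 3) ℤ.* j ℤ.* j ℤ.+ j ∣ * T σ L M j j (pow q 6)

module Submission where

-- Proof by generating functions in an auxiliary variable z, Q = q⁶:
--  1. (q-binomial theorem) [z^m] (-xz; b)_N = b^(m choose 2) x^m [N, m]_b, and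
--     1/(z²; b)_(N+1) = Σ_k [N+k, k]_b z^(2k).
--  2. The double series S m n = Σ_{a,b} q^(3j²+j) [m+b, a]_Q [n+a, b]_Q z^(a+b), j = b - a,
--     satisfies (z²; Q)_(m+n+1) · S m n = (-q⁴z; Q)_n (-q²z; Q)_m, by induction on m and n
--     from two recurrences that are the q-Pascal rule coefficientwise.
--  3. Grouping the factors of (-xz; q²)_(3M) by residues mod 3 and using 1. and 2.:
--     (-xz; q²)_(3M) / (z²; Q)_(2M+1) = (-yz; Q)_M · S M M,  (x, y) = (1, 1) or (q², q⁶).
--  4. The z^L coefficient of the left side is the left-hand side of the theorem; expanding T
--     and exchanging the sums over j and n shows that the z^L coefficient of the right side is
--     the right-hand side (the inner sum over j being the z^(L-n) coefficient of S M M).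

open import Level using (Level)
open import Defs
open import Algebra.Bundles using (CommutativeRing; CommutativeMonoid)
open import Data.Nat using (ℕ; _≤_)
open import Data.Sign using (Sign)
open import Data.Nat as ℕ using (zero; suc; _<_; _∸_; s≤s)
import Data.Nat.Properties as ℕP
open import Data.Nat.DivMod using (_%_; _/_; m*n%n≡0; m*n/n≡m; [m+kn]%n≡m%n)
open import Data.Nat.Tactic.RingSolver using (solve-∀)
open import Data.Integer as ℤ using (ℤ; +_; -[1+_])
import Data.Integer.Properties as ℤP
import Data.Integer.Tactic.RingSolver as ℤSolver
open import Data.Bool using (true; false; if_then_else_)
open import Data.Product using (∃; _,_)
open import Data.Sum using (_⊎_; inj₁; inj₂)
open import Relation.Nullary using (yes; no; contradiction)
open import Relation.Binary.Definitions using (tri<; tri≈; tri>)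
open import Relation.Binary.PropositionalEquality as ≡ using (_≡_; _≢_; ≢-sym)

module Arithmetic where
  open import Data.Nat using (_+_; _*_)
  open import Data.Nat.Combinatorics using (_C_; nCk+nC[k+1]≡[n+1]C[k+1]; nC1≡n)
  open ≡ using (refl; sym; trans; cong; cong₂)
  open ≡.≡-Reasoning

  -- Triangular numbers tri m = m(m-1)/2 = (m choose 2); q^(tri m) is the
  -- exponent appearing in the q-binomial theorem.
  tri : ℕ → ℕ
  tri zero    = 0
  tri (suc m) = tri m + m

  C2≡tri : ∀ n → n C 2 ≡ tri n
  C2≡tri zero    = refl
  C2≡tri (suc n) = begin
    suc n C 2          ≡⟨ sym (nCk+nC[k+1]≡[n+1]C[k+1] n 1) ⟩
    n C 1 + n C 2      ≡⟨ cong₂ _+_ (nC1≡n n) (C2≡tri n) ⟩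
    n + tri n          ≡⟨ ℕP.+-comm n (tri n) ⟩
    tri n + n          ∎

  tri-double : ∀ m → tri m + tri m + m ≡ m * m
  tri-double zero    = refl
  tri-double (suc m) = begin
    (tri m + m) + (tri m + m) + suc m  ≡⟨ regroup (tri m) m ⟩
    (tri m + tri m + m) + suc m + m    ≡⟨ cong (λ x → x + suc m + m) (tri-double m) ⟩
    m * m + suc m + m                  ≡⟨ square m ⟩
    suc m * suc m                      ∎
    where
    regroup : ∀ t m → (t + m) + (t + m) + suc m ≡ (t + t + m) + suc m + m
    regroup = solve-∀
    square : ∀ m → m * m + suc m + m ≡ suc m * suc m
    square = solve-∀

  lExp⁺≡ : ∀ m → 2 * tri m ≡ m * m ∸ m
  lExp⁺≡ m = begin
    2 * tri m               ≡⟨ double (tri m) ⟩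
    tri m + tri m           ≡⟨ ℕP.m+n∸n≡m (tri m + tri m) m ⟨
    tri m + tri m + m ∸ m   ≡⟨ cong (_∸ m) (tri-double m) ⟩
    m * m ∸ m               ∎
    where
    double : ∀ t → 2 * t ≡ t + t
    double = solve-∀

  lExp⁻≡ : ∀ m → 2 * tri m + 2 * m ≡ m * m + m
  lExp⁻≡ m = trans (regroup (tri m) m) (cong (_+ m) (tri-double m))
    where
    regroup : ∀ t m → 2 * t + 2 * m ≡ t + t + m + m
    regroup = solve-∀

  -- ex a b = 3j² + j with j = b - a (see ex≡∣3j²+j∣), defined by recursion so
  -- that it stays in ℕ.  It is the q-exponent of the double series S below.
  ex : ℕ → ℕ → ℕ
  ex zero    b       = 3 * b * b + b
  ex (suc a) zero    = 3 * a * a + 5 * a + 2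
  ex (suc a) (suc b) = ex a b

  ex-diag : ∀ k → ex k k ≡ 0
  ex-diag zero    = refl
  ex-diag (suc k) = ex-diag k

  shift6 : ∀ x y → x + 6 * suc y ≡ x + 6 * y + 6
  shift6 = solve-∀

  shift6+ : ∀ x y r → x + 6 * suc y + r ≡ x + 6 * y + r + 6
  shift6+ = solve-∀

  -- Moving j down by one (a ↦ a+1): 3(j-1)²+(j-1) = 3j²+j - 6j + 2.
  ex-stepˡ : ∀ a b → ex a b + 6 * a + 2 ≡ ex (suc a) b + 6 * b
  ex-stepˡ zero    zero    = refl
  ex-stepˡ zero    (suc b) = lemma b
    where
    lemma : ∀ b → (3 * suc b * suc b + suc b) + 6 * 0 + 2 ≡ (3 * b * b + b) + 6 * suc b
    lemma = solve-∀
  ex-stepˡ (suc a) zero    = lemma a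
    where
    lemma : ∀ a → (3 * a * a + 5 * a + 2) + 6 * suc a + 2 ≡ (3 * suc a * suc a + 5 * suc a + 2) + 6 * 0
    lemma = solve-∀
  ex-stepˡ (suc a) (suc b) = begin
    ex a b + 6 * suc a + 2   ≡⟨ shift6+ (ex a b) a 2 ⟩
    ex a b + 6 * a + 2 + 6   ≡⟨ cong (_+ 6) (ex-stepˡ a b) ⟩
    ex (suc a) b + 6 * b + 6 ≡⟨ shift6 (ex (suc a) b) b ⟨
    ex (suc a) b + 6 * suc b ∎

  -- Moving j up by one (b ↦ b+1): 3(j+1)²+(j+1) = 3j²+j + 6j + 4.
  ex-stepʳ : ∀ a b → ex a b + 6 * b + 4 ≡ ex a (suc b) + 6 * a
  ex-stepʳ zero    b       = lemma b
    where
    lemma : ∀ b → (3 * b * b + b) + 6 * b + 4 ≡ (3 * suc b * suc b + suc b) + 6 * 0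
    lemma = solve-∀
  ex-stepʳ (suc a) zero    = begin
    ex (suc a) 0 + 6 * 0 + 4   ≡⟨ cong (_+ 4) (ex-stepˡ a 0) ⟨
    ex a 0 + 6 * a + 2 + 4     ≡⟨ regroup (ex a 0) a ⟩
    ex a 0 + 6 * suc a         ∎
    where
    regroup : ∀ x a → x + 6 * a + 2 + 4 ≡ x + 6 * suc a
    regroup = solve-∀
  ex-stepʳ (suc a) (suc b) = begin
    ex a b + 6 * suc b + 4   ≡⟨ shift6+ (ex a b) b 4 ⟩
    ex a b + 6 * b + 4 + 6   ≡⟨ cong (_+ 6) (ex-stepʳ a b) ⟩
    ex a (suc b) + 6 * a + 6 ≡⟨ shift6 (ex a (suc b)) a ⟨
    ex a (suc b) + 6 * suc a ∎

  -- Bookkeeping of exponents in the two recurrences for S (see stepₘ/stepₙ):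
  -- the Pascal rule produces Q^d = q^(6d) with d determined by a linear
  -- relation, and these lemmas match the resulting total q-exponents.
  shift-exp : ∀ x y u v r s d M → x + 6 * u + r ≡ y + 6 * v → v + d ≡ M + suc u → r + s ≡ 6 →
              x + 6 * d ≡ (6 * M + s) + y
  shift-exp x y u v r s d M step rel rs = ℕP.+-cancelʳ-≡ (6 * v) _ _ (begin
    x + 6 * d + 6 * v             ≡⟨ collect x d v ⟩
    x + 6 * (v + d)               ≡⟨ cong (λ z → x + 6 * z) rel ⟩
    x + 6 * (M + suc u)           ≡⟨ expand x M u ⟩
    x + 6 * u + 6 * M + 6         ≡⟨ cong (λ z → x + 6 * u + 6 * M + z) rs ⟨
    x + 6 * u + 6 * M + (r + s)   ≡⟨ regroup x u M r s ⟩
    (x + 6 * u + r) + (6 * M + s) ≡⟨ cong (_+ (6 * M + s)) step ⟩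
    (y + 6 * v) + (6 * M + s)     ≡⟨ swap y v (6 * M + s) ⟩
    (6 * M + s) + y + 6 * v       ∎)
    where
    collect : ∀ x d v → x + 6 * d + 6 * v ≡ x + 6 * (v + d)
    collect = solve-∀
    expand : ∀ x M u → x + 6 * (M + suc u) ≡ x + 6 * u + 6 * M + 6
    expand = solve-∀
    regroup : ∀ x u M r s → x + 6 * u + 6 * M + (r + s) ≡ (x + 6 * u + r) + (6 * M + s)
    regroup = solve-∀
    swap : ∀ y v w → (y + 6 * v) + w ≡ w + y + 6 * v
    swap = solve-∀

  shift-exp₀ : ∀ x y v r d M → y + 6 * v + r ≡ x + 6 * 0 → v + d ≡ M + 0 →
               x + 6 * d ≡ (6 * M + r) + y
  shift-exp₀ x y v r d M step rel = begin
    x + 6 * d                 ≡⟨ cong (_+ 6 * d) (trans step (ℕP.+-identityʳ x)) ⟨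
    y + 6 * v + r + 6 * d     ≡⟨ collect y v r d ⟩
    y + r + 6 * (v + d)       ≡⟨ cong (λ z → y + r + 6 * z) rel ⟩
    y + r + 6 * (M + 0)       ≡⟨ regroup y r M ⟩
    (6 * M + r) + y           ∎
    where
    collect : ∀ y v r d → y + 6 * v + r + 6 * d ≡ y + r + 6 * (v + d)
    collect = solve-∀
    regroup : ∀ y r M → y + r + 6 * (M + 0) ≡ (6 * M + r) + y
    regroup = solve-∀

  sum-of-gaps : ∀ a b d₁ d₂ u v s → a + d₁ ≡ u → b + d₂ ≡ v → u + v ≡ s + (a + b) → d₁ + d₂ ≡ s
  sum-of-gaps a b d₁ d₂ u v s e₁ e₂ e = ℕP.+-cancelʳ-≡ (a + b) _ _ (begin
    d₁ + d₂ + (a + b)    ≡⟨ regroup d₁ d₂ a b ⟩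
    (a + d₁) + (b + d₂)  ≡⟨ cong₂ _+_ e₁ e₂ ⟩
    u + v                ≡⟨ e ⟩
    s + (a + b)          ∎)
    where
    regroup : ∀ d₁ d₂ a b → d₁ + d₂ + (a + b) ≡ (a + d₁) + (b + d₂)
    regroup = solve-∀

  even-or-odd : ∀ s → (∃ λ k → s ≡ k * 2) ⊎ (∃ λ k → s ≡ suc (k * 2))
  even-or-odd zero = inj₁ (0 , refl)
  even-or-odd (suc s) with even-or-odd s
  ... | inj₁ (k , e) = inj₂ (k , cong suc e)
  ... | inj₂ (k , e) = inj₁ (suc k , cong suc e)

  double≢odd : ∀ a k → a + a ≢ suc (k * 2)
  double≢odd a k e = ℕP.even≢odd a k (trans (twice a) (trans e (cong suc (ℕP.*-comm k 2))))
    where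
    twice : ∀ a → 2 * a ≡ a + a
    twice = solve-∀

  even-test : ∀ k → ((k * 2) % 2 ℕ.≡ᵇ 0) ≡ true
  even-test k = cong (ℕ._≡ᵇ 0) (m*n%n≡0 k 2)

  odd-test : ∀ k → (suc (k * 2) % 2 ℕ.≡ᵇ 0) ≡ false
  odd-test k = cong (ℕ._≡ᵇ 0) ([m+kn]%n≡m%n 1 k 2)

  ⊖-neg : ∀ {L m} → L < m → ∃ λ k → L ℤ.⊖ m ≡ -[1+ k ]
  ⊖-neg {zero}  {suc m} _          = m , refl
  ⊖-neg {suc L} {suc m} (s≤s L<m) with ⊖-neg L<m
  ... | k , e = k , trans (ℤP.[1+m]⊖[1+n]≡m⊖n L m) e

  diff-suc : ∀ a b → (+ suc b) ℤ.- (+ suc a) ≡ (+ b) ℤ.- (+ a)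
  diff-suc a b = begin
    (+ suc b) ℤ.- (+ suc a) ≡⟨ ℤP.m-n≡m⊖n (suc b) (suc a) ⟩
    suc b ℤ.⊖ suc a         ≡⟨ ℤP.[1+m]⊖[1+n]≡m⊖n b a ⟩
    b ℤ.⊖ a                 ≡⟨ ℤP.m-n≡m⊖n b a ⟨
    (+ b) ℤ.- (+ a)         ∎

  minus-below-zero : ∀ {L n e} k → L ℤ.⊖ n ≡ -[1+ e ] → (+ L) ℤ.- (+ k) ℤ.- (+ n) ≡ -[1+ e + k ]
  minus-below-zero {L} {n} {e} k L⊖n = begin
    (+ L) ℤ.- (+ k) ℤ.- (+ n)   ≡⟨ reorder (+ L) (+ k) (+ n) ⟩
    ((+ L) ℤ.- (+ n)) ℤ.- (+ k) ≡⟨ cong (ℤ._- (+ k)) (trans (ℤP.m-n≡m⊖n L n) L⊖n) ⟩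
    -[1+ e ] ℤ.- (+ k)          ≡⟨ more-negative (+ e) (+ k) ⟩
    -[1+ e + k ]                ∎
    where
    reorder : ∀ x k y → x ℤ.- k ℤ.- y ≡ (x ℤ.- y) ℤ.- k
    reorder = ℤSolver.solve-∀
    more-negative : ∀ x y → ℤ.- (+ 1 ℤ.+ x) ℤ.- y ≡ ℤ.- (+ 1 ℤ.+ (x ℤ.+ y))
    more-negative = ℤSolver.solve-∀

  mirror : ∀ d i → i ≤ 2 * d → (+ (2 * d ∸ i)) ℤ.- (+ d) ≡ (+ d) ℤ.- (+ i)
  mirror d i i≤ = begin
    (+ (2 * d ∸ i)) ℤ.- (+ d)                        ≡⟨ shift (+ (2 * d ∸ i)) (+ i) (+ d) ⟩
    (+ (2 * d ∸ i)) ℤ.+ (+ i) ℤ.- (+ i) ℤ.- (+ d)    ≡⟨ cong (λ x → x ℤ.- (+ i) ℤ.- (+ d))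
                                                         (trans (sym (ℤP.pos-+ (2 * d ∸ i) i)) (cong +_ (ℕP.m∸n+n≡m i≤))) ⟩
    (+ (2 * d)) ℤ.- (+ i) ℤ.- (+ d)                  ≡⟨ cong (λ x → x ℤ.- (+ i) ℤ.- (+ d)) (ℤP.pos-* 2 d) ⟩
    (+ 2) ℤ.* (+ d) ℤ.- (+ i) ℤ.- (+ d)              ≡⟨ fold (+ d) (+ i) ⟩
    (+ d) ℤ.- (+ i)                                  ∎
    where
    shift : ∀ u i d → u ℤ.- d ≡ u ℤ.+ i ℤ.- i ℤ.- d
    shift = ℤSolver.solve-∀
    fold : ∀ d i → (+ 2) ℤ.* d ℤ.- i ℤ.- d ≡ d ℤ.- i
    fold = ℤSolver.solve-∀

  ex≡∣3j²+j∣ : ∀ a b → let j = (+ b) ℤ.- (+ a) in ℤ.∣ (+ 3) ℤ.* j ℤ.* j ℤ.+ j ∣ ≡ ex a b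
  ex≡∣3j²+j∣ zero b = cong ℤ.∣_∣ (trans (poly (+ b)) (sym cast))
    where
    poly : ∀ x → (+ 3) ℤ.* (x ℤ.- + 0) ℤ.* (x ℤ.- + 0) ℤ.+ (x ℤ.- + 0) ≡ (+ 3) ℤ.* x ℤ.* x ℤ.+ x
    poly = ℤSolver.solve-∀
    cast : + (3 * b * b + b) ≡ (+ 3) ℤ.* (+ b) ℤ.* (+ b) ℤ.+ (+ b)
    cast = begin
      + (3 * b * b + b)                     ≡⟨ ℤP.pos-+ (3 * b * b) b ⟩
      + (3 * b * b) ℤ.+ + b                 ≡⟨ cong (ℤ._+ + b) (ℤP.pos-* (3 * b) b) ⟩
      + (3 * b) ℤ.* + b ℤ.+ + b             ≡⟨ cong (λ z → z ℤ.* + b ℤ.+ + b) (ℤP.pos-* 3 b) ⟩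
      (+ 3) ℤ.* (+ b) ℤ.* (+ b) ℤ.+ (+ b)   ∎
  ex≡∣3j²+j∣ (suc a) zero = cong ℤ.∣_∣ (trans (poly (+ a)) (sym cast))
    where
    poly : ∀ x → let j = + 0 ℤ.- (+ 1 ℤ.+ x) in
           (+ 3) ℤ.* j ℤ.* j ℤ.+ j ≡ (+ 3) ℤ.* x ℤ.* x ℤ.+ (+ 5) ℤ.* x ℤ.+ + 2
    poly = ℤSolver.solve-∀
    cast : + (3 * a * a + 5 * a + 2) ≡ (+ 3) ℤ.* (+ a) ℤ.* (+ a) ℤ.+ (+ 5) ℤ.* (+ a) ℤ.+ + 2
    cast = begin
      + (3 * a * a + 5 * a + 2)                        ≡⟨ ℤP.pos-+ (3 * a * a + 5 * a) 2 ⟩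
      + (3 * a * a + 5 * a) ℤ.+ + 2                    ≡⟨ cong (ℤ._+ + 2) (ℤP.pos-+ (3 * a * a) (5 * a)) ⟩
      + (3 * a * a) ℤ.+ + (5 * a) ℤ.+ + 2              ≡⟨ cong₂ (λ u v → u ℤ.+ v ℤ.+ + 2)
                                                            (trans (ℤP.pos-* (3 * a) a) (cong (ℤ._* + a) (ℤP.pos-* 3 a)))
                                                            (ℤP.pos-* 5 a) ⟩
      (+ 3) ℤ.* (+ a) ℤ.* (+ a) ℤ.+ (+ 5) ℤ.* (+ a) ℤ.+ + 2 ∎
  ex≡∣3j²+j∣ (suc a) (suc b) =
    trans (cong (λ j → ℤ.∣ (+ 3) ℤ.* j ℤ.* j ℤ.+ j ∣) (diff-suc a b)) (ex≡∣3j²+j∣ a b)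

module Basics {c ℓ : Level} (R : CommutativeRing c ℓ) where
  open CommutativeRing R hiding (zero)
  open Series R
  open import Relation.Binary.Reasoning.Setoid setoid
  open import Algebra.Properties.Ring ring using (-‿distribˡ-*)
  open import Algebra.Properties.Group +-group using (//-rightDividesʳ)
  open import Algebra.Properties.Semiring.Exp semiring using (_^_; ^-homo-*; ^-assocʳ)
  open import Algebra.Solver.Ring.NaturalCoefficients.Default commutativeSemiring public
    using (solve; _:=_; _:+_; _:*_; con)

  +-*-cancel : ∀ a x y → (a + x * y) + (- x) * y ≈ a
  +-*-cancel a x y = trans (+-congˡ (sym (-‿distribˡ-* x y))) (//-rightDividesʳ (x * y) a)

  pow≡^ : ∀ x n → pow x n ≡ x ^ n
  pow≡^ x zero    = ≡.refl
  pow≡^ x (suc n) = ≡.cong (x *_) (pow≡^ x n)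

  pow-≡ : ∀ x {m n} → m ≡ n → pow x m ≈ pow x n
  pow-≡ x e = reflexive (≡.cong (pow x) e)

  pow-+ : ∀ x m n → pow x (m ℕ.+ n) ≈ pow x m * pow x n
  pow-+ x m n = begin
    pow x (m ℕ.+ n)       ≡⟨ pow≡^ x (m ℕ.+ n) ⟩
    x ^ (m ℕ.+ n)         ≈⟨ ^-homo-* x m n ⟩
    x ^ m * x ^ n         ≡⟨ ≡.cong₂ _*_ (pow≡^ x m) (pow≡^ x n) ⟨
    pow x m * pow x n     ∎

  pow-* : ∀ x m n → pow x (m ℕ.* n) ≈ pow (pow x m) n
  pow-* x m n = begin
    pow x (m ℕ.* n)       ≡⟨ pow≡^ x (m ℕ.* n) ⟩
    x ^ (m ℕ.* n)         ≈⟨ ^-assocʳ x m n ⟨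
    (x ^ m) ^ n           ≡⟨ ≡.cong (_^ n) (pow≡^ x m) ⟨
    pow x m ^ n           ≡⟨ pow≡^ (pow x m) n ⟨
    pow (pow x m) n       ∎

  pow-1# : ∀ n → pow 1# n ≈ 1#
  pow-1# zero    = refl
  pow-1# (suc n) = trans (*-identityˡ _) (pow-1# n)

  sum-cong< : ∀ N {f g : ℕ → Carrier} → (∀ i → i < N → f i ≈ g i) → sumTo N f ≈ sumTo N g
  sum-cong< zero    e = refl
  sum-cong< (suc N) e = +-cong (sum-cong< N (λ i i<N → e i (ℕP.m<n⇒m<1+n i<N))) (e N ℕP.≤-refl)

  sum-cong : ∀ N {f g : ℕ → Carrier} → (∀ i → f i ≈ g i) → sumTo N f ≈ sumTo N g
  sum-cong N e = sum-cong< N (λ i _ → e i)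

  sum-zero : ∀ N {f : ℕ → Carrier} → (∀ i → i < N → f i ≈ 0#) → sumTo N f ≈ 0#
  sum-zero N {f} e = trans (sum-cong< N e) (go N)
    where
    go : ∀ N → sumTo N (λ _ → 0#) ≈ 0#
    go zero    = refl
    go (suc N) = trans (+-identityʳ _) (go N)

  sum-+ : ∀ N (f g : ℕ → Carrier) → sumTo N (λ i → f i + g i) ≈ sumTo N f + sumTo N g
  sum-+ zero    f g = sym (+-identityʳ 0#)
  sum-+ (suc N) f g = trans (+-congʳ (sum-+ N f g))
    (solve 4 (λ a b c d → (a :+ b) :+ (c :+ d) := (a :+ c) :+ (b :+ d)) refl _ _ _ _)

  sum-*ˡ : ∀ N x (f : ℕ → Carrier) → sumTo N (λ i → x * f i) ≈ x * sumTo N f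
  sum-*ˡ zero    x f = sym (zeroʳ x)
  sum-*ˡ (suc N) x f = trans (+-congʳ (sum-*ˡ N x f)) (sym (distribˡ x _ _))

  sum-first : ∀ N (f : ℕ → Carrier) → sumTo (suc N) f ≈ f 0 + sumTo N (λ i → f (suc i))
  sum-first zero    f = trans (+-identityˡ _) (sym (+-identityʳ _))
  sum-first (suc N) f = trans (+-congʳ (sum-first N f)) (+-assoc _ _ _)

  sum-pad : ∀ N d (f : ℕ → Carrier) → (∀ i → N ≤ i → f i ≈ 0#) → sumTo (N ℕ.+ d) f ≈ sumTo N f
  sum-pad N zero    f e = reflexive (≡.cong (λ k → sumTo k f) (ℕP.+-identityʳ N))
  sum-pad N (suc d) f e = begin
    sumTo (N ℕ.+ suc d) f            ≡⟨ ≡.cong (λ k → sumTo k f) (ℕP.+-suc N d) ⟩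
    sumTo (N ℕ.+ d) f + f (N ℕ.+ d)  ≈⟨ +-cong (sum-pad N d f e) (e _ (ℕP.m≤m+n N d)) ⟩
    sumTo N f + 0#                   ≈⟨ +-identityʳ _ ⟩
    sumTo N f                        ∎

  sum-resize : ∀ N N' (f : ℕ → Carrier) → (∀ i → N ≤ i → f i ≈ 0#) → (∀ i → N' ≤ i → f i ≈ 0#) →
               sumTo N f ≈ sumTo N' f
  sum-resize N N' f vanN vanN' = begin
    sumTo N f            ≈⟨ sum-pad N N' f vanN ⟨
    sumTo (N ℕ.+ N') f   ≡⟨ ≡.cong (λ k → sumTo k f) (ℕP.+-comm N N') ⟩
    sumTo (N' ℕ.+ N) f   ≈⟨ sum-pad N' N f vanN' ⟩
    sumTo N' f           ∎

  sum-swap : ∀ N M (F : ℕ → ℕ → Carrier) →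
             sumTo N (λ i → sumTo M (F i)) ≈ sumTo M (λ j → sumTo N (λ i → F i j))
  sum-swap zero    M F = sym (sum-zero M (λ _ _ → refl))
  sum-swap (suc N) M F = begin
    sumTo N (λ i → sumTo M (F i)) + sumTo M (F N)          ≈⟨ +-congʳ (sum-swap N M F) ⟩
    sumTo M (λ j → sumTo N (λ i → F i j)) + sumTo M (F N)  ≈⟨ sum-+ M _ _ ⟨
    sumTo M (λ j → sumTo N (λ i → F i j) + F N j)          ∎

  sum-reverse : ∀ N (f : ℕ → Carrier) → sumTo N f ≈ sumTo N (λ i → f (N ∸ suc i))
  sum-reverse zero    f = refl
  sum-reverse (suc N) f = begin
    sumTo N f + f N                          ≈⟨ +-congʳ (sum-reverse N f) ⟩
    sumTo N (λ i → f (N ∸ suc i)) + f N      ≈⟨ +-comm _ _ ⟩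
    f N + sumTo N (λ i → f (N ∸ suc i))      ≈⟨ sum-first N _ ⟨
    sumTo (suc N) (λ i → f (suc N ∸ suc i))  ∎

  sum-single : ∀ N k (f : ℕ → Carrier) → k < N → (∀ i → i < N → i ≢ k → f i ≈ 0#) → sumTo N f ≈ f k
  sum-single (suc N) k f k<N e with k ℕ.≟ N
  ... | yes ≡.refl = trans (+-congʳ (sum-zero N (λ i i<N → e i (ℕP.m<n⇒m<1+n i<N) (ℕP.<⇒≢ i<N))))
                           (+-identityˡ _)
  ... | no k≢N     = trans (+-cong (sum-single N k f (ℕP.≤∧≢⇒< (ℕP.≤-pred k<N) k≢N)
                                                   (λ i i<N → e i (ℕP.m<n⇒m<1+n i<N)))
                                   (e N ℕP.≤-refl (≢-sym k≢N)))
                           (+-identityʳ _)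

  sum-even-odd : ∀ d (g : ℕ → Carrier) →
                 sumTo (suc (d ℕ.* 2)) g ≈ sumTo (suc d) (λ a → g (a ℕ.* 2)) + sumTo d (λ a → g (suc (a ℕ.* 2)))
  sum-even-odd zero    g = sym (+-identityʳ _)
  sum-even-odd (suc d) g = trans (+-congʳ (+-congʳ (sum-even-odd d g)))
    (solve 4 (λ E O x y → ((E :+ O) :+ x) :+ y := (E :+ y) :+ (O :+ x)) refl _ _ _ _)

  gauss-zero : ∀ x n → gauss x n 0 ≈ 1#
  gauss-zero x zero    = refl
  gauss-zero x (suc n) = refl

  gauss-> : ∀ x n k → n < k → gauss x n k ≈ 0#
  gauss-> x zero    (suc k) _          = refl
  gauss-> x (suc n) (suc k) (s≤s n<k) = begin
    gauss x n k + pow x (suc k) * gauss x n (suc k) ≈⟨ +-cong (gauss-> x n k n<k)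
                                                          (*-congˡ (gauss-> x n (suc k) (ℕP.m<n⇒m<1+n n<k))) ⟩
    0# + pow x (suc k) * 0#                          ≈⟨ trans (+-identityˡ _) (zeroʳ _) ⟩
    0#                                               ∎

  gauss-diag : ∀ x n → gauss x n n ≈ 1#
  gauss-diag x zero    = refl
  gauss-diag x (suc n) = begin
    gauss x n n + pow x (suc n) * gauss x n (suc n) ≈⟨ +-cong (gauss-diag x n) (*-congˡ (gauss-> x n (suc n) ℕP.≤-refl)) ⟩
    1# + pow x (suc n) * 0#                          ≈⟨ trans (+-congˡ (zeroʳ _)) (+-identityʳ _) ⟩
    1#                                               ∎

  gauss-guard : ∀ x n k {u v} → (k ≤ n → u ≈ v) → gauss x n k * u ≈ gauss x n k * v
  gauss-guard x n k h with k ℕ.≤? n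
  ... | yes k≤n = *-congˡ (h k≤n)
  ... | no  k≰n = trans (*-congʳ vanish) (trans (zeroˡ _) (sym (trans (*-congʳ vanish) (zeroˡ _))))
    where vanish = gauss-> x n k (ℕP.≰⇒> k≰n)

  gauss-pascal′ : ∀ x n k → gauss x (suc n) (suc k) ≈ gauss x n (suc k) + pow x (n ∸ k) * gauss x n k
  gauss-pascal′ x zero zero = begin
    1# + x * 1# * 0#    ≈⟨ trans (+-congˡ (zeroʳ _)) (+-identityʳ _) ⟩
    1#                  ≈⟨ trans (+-identityˡ _) (*-identityˡ _) ⟨
    0# + 1# * 1#        ∎
  gauss-pascal′ x zero (suc k) = begin
    0# + pow x (suc (suc k)) * 0#  ≈⟨ +-congˡ (zeroʳ _) ⟩
    0# + 0#                        ≈⟨ +-congˡ (zeroʳ _) ⟨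
    0# + 1# * 0#                   ∎
  gauss-pascal′ x (suc n) zero = begin
    1# + x * 1# * gauss x (suc n) 1                        ≈⟨ +-congˡ (*-congˡ (gauss-pascal′ x n 0)) ⟩
    1# + x * 1# * (gauss x n 1 + pow x n * gauss x n 0)    ≈⟨ +-congˡ (*-congˡ (+-congˡ (*-congˡ (gauss-zero x n)))) ⟩
    1# + x * 1# * (gauss x n 1 + pow x n * 1#)             ≈⟨ solve 3 (λ x g p → con 1 :+ x :* con 1 :* (g :+ p :* con 1)
                                                                      := (con 1 :+ x :* con 1 :* g) :+ (x :* p) :* con 1)
                                                                  refl x _ _ ⟩
    (1# + x * 1# * gauss x n 1) + pow x (suc n) * 1#       ≈⟨ +-congʳ (+-congʳ (gauss-zero x n)) ⟨
    gauss x (suc n) 1 + pow x (suc n) * gauss x (suc n) 0  ∎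
  gauss-pascal′ x (suc n) (suc k) = begin
    gauss x (suc n) (suc k) + p * gauss x (suc n) (suc (suc k))
      ≈⟨ +-cong (gauss-pascal′ x n k) (*-congˡ (gauss-pascal′ x n (suc k))) ⟩
    (A + s * B) + p * (C + r * A)
      ≈⟨ solve 6 (λ A B C p r s → (A :+ s :* B) :+ p :* (C :+ r :* A)
                               := ((A :+ p :* C) :+ s :* B) :+ A :* (p :* r)) refl A B C p r s ⟩
    ((A + p * C) + s * B) + A * (p * r)
      ≈⟨ +-congˡ (gauss-guard x n (suc k) exponents) ⟩
    ((A + p * C) + s * B) + A * (s * t)
      ≈⟨ solve 6 (λ A B C s t p → ((A :+ p :* C) :+ s :* B) :+ A :* (s :* t)
                               := (A :+ p :* C) :+ s :* (B :+ t :* A)) refl A B C s t p ⟩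
    (A + p * C) + s * (B + t * A)  ∎
    where
    A = gauss x n (suc k)
    B = gauss x n k
    C = gauss x n (suc (suc k))
    p = pow x (suc (suc k))
    r = pow x (n ∸ suc k)
    s = pow x (n ∸ k)
    t = pow x (suc k)
    exponents : suc k ≤ n → p * r ≈ s * t
    exponents k<n = begin
      p * r                          ≈⟨ pow-+ x (suc (suc k)) (n ∸ suc k) ⟨
      pow x (suc (suc k) ℕ.+ (n ∸ suc k)) ≡⟨ ≡.cong (pow x) (≡.cong suc (ℕP.m+[n∸m]≡n k<n)) ⟩
      pow x (suc n)                  ≡⟨ ≡.cong (pow x) (≡.trans (≡.cong suc (≡.sym (ℕP.m∸n+n≡m (ℕP.<⇒≤ k<n))))
                                                                 (≡.sym (ℕP.+-suc (n ∸ k) k))) ⟩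
      pow x ((n ∸ k) ℕ.+ suc k)      ≈⟨ pow-+ x (n ∸ k) (suc k) ⟩
      s * t                          ∎

  gauss-sym : ∀ x n k l → n ≡ k ℕ.+ l → gauss x n k ≈ gauss x n l
  gauss-sym x n zero l ≡.refl = trans (gauss-zero x l) (sym (gauss-diag x l))
  gauss-sym x n (suc k) zero e = begin
    gauss x n (suc k)        ≡⟨ ≡.cong (λ m → gauss x m (suc k)) (≡.trans e (ℕP.+-identityʳ (suc k))) ⟩
    gauss x (suc k) (suc k)  ≈⟨ gauss-diag x (suc k) ⟩
    1#                       ≈⟨ gauss-zero x n ⟨
    gauss x n 0              ∎
  gauss-sym x (suc m) (suc k) (suc l) e = begin
    gauss x m k + pow x (suc k) * gauss x m (suc k) ≈⟨ +-cong (gauss-sym x m k (suc l) m≡k+1+l)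
                                                         (*-cong (pow-≡ x (≡.sym gap)) (gauss-sym x m (suc k) l m≡1+k+l)) ⟩
    gauss x m (suc l) + pow x (m ∸ l) * gauss x m l ≈⟨ gauss-pascal′ x m l ⟨
    gauss x (suc m) (suc l)                         ∎
    where
    m≡k+1+l : m ≡ k ℕ.+ suc l
    m≡k+1+l = ℕP.suc-injective e
    m≡1+k+l : m ≡ suc k ℕ.+ l
    m≡1+k+l = ≡.trans m≡k+1+l (ℕP.+-suc k l)
    gap : m ∸ l ≡ suc k
    gap = ≡.trans (≡.cong (_∸ l) m≡1+k+l) (ℕP.m+n∸n≡m (suc k) l)

-- Formal power series over R, represented by their coefficient sequences,
-- with the Cauchy product _⋆_.  Only finitely many coefficients are ever
-- inspected, so no convergence questions arise.
module FormalSeries {c ℓ : Level} (R : CommutativeRing c ℓ) where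
  open CommutativeRing R hiding (zero)
  open Series R
  open Basics R
  open import Relation.Binary.Reasoning.Setoid setoid

  Seq : Set c
  Seq = ℕ → Carrier

  -- Double sequences, i.e. series in two variables.
  Arr : Set c
  Arr = ℕ → ℕ → Carrier

  infix 4 _≋_
  _≋_ : Seq → Seq → Set ℓ
  f ≋ g = ∀ n → f n ≈ g n

  ≋-refl : ∀ {f} → f ≋ f
  ≋-refl _ = refl

  ≋-sym : ∀ {f g} → f ≋ g → g ≋ f
  ≋-sym e n = sym (e n)

  ≋-trans : ∀ {f g h} → f ≋ g → g ≋ h → f ≋ h
  ≋-trans e e' n = trans (e n) (e' n)

  -- Anti-diagonal sums: diag T n = Σ_{a + b = n} T a b.
  diag : Arr → Seq
  diag T zero    = T 0 0
  diag T (suc n) = T 0 (suc n) + diag (λ a b → T (suc a) b) n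

  infixl 7 _⋆_
  infixl 6 _⊕_
  infixr 8 _·_

  _⋆_ : Seq → Seq → Seq
  f ⋆ g = diag (λ a b → f a * g b)

  _⊕_ : Seq → Seq → Seq
  (f ⊕ g) n = f n + g n

  _·_ : Carrier → Seq → Seq
  (x · f) n = x * f n

  -- The unit series 1.
  δ : Seq
  δ zero    = 1#
  δ (suc n) = 0#

  -- Multiplication by the variable z.
  sh : Seq → Seq
  sh f zero    = 0#
  sh f (suc n) = f n

  sh-cong : ∀ {f g} → f ≋ g → sh f ≋ sh g
  sh-cong e zero    = refl
  sh-cong e (suc n) = e n

  diag-cong : ∀ {T U} → (∀ a b → T a b ≈ U a b) → diag T ≋ diag U
  diag-cong e zero    = e 0 0
  diag-cong e (suc n) = +-cong (e 0 (suc n)) (diag-cong (λ a b → e (suc a) b) n)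

  diag-+ : ∀ T U → diag (λ a b → T a b + U a b) ≋ diag T ⊕ diag U
  diag-+ T U zero    = refl
  diag-+ T U (suc n) = trans (+-congˡ (diag-+ (λ a b → T (suc a) b) (λ a b → U (suc a) b) n))
    (solve 4 (λ a b c d → (a :+ b) :+ (c :+ d) := (a :+ c) :+ (b :+ d)) refl _ _ _ _)

  diag-* : ∀ x T → diag (λ a b → x * T a b) ≋ x · diag T
  diag-* x T zero    = refl
  diag-* x T (suc n) = trans (+-congˡ (diag-* x (λ a b → T (suc a) b) n)) (sym (distribˡ x _ _))

  diag-lin : ∀ T U x → diag (λ a b → T a b + x * U a b) ≋ diag T ⊕ x · diag U
  diag-lin T U x n = trans (diag-+ T (λ a b → x * U a b) n) (+-congˡ (diag-* x U n))

  diag-zero : ∀ T → (∀ a b → T a b ≈ 0#) → diag T ≋ (λ _ → 0#)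
  diag-zero T e zero    = e 0 0
  diag-zero T e (suc n) = trans (+-cong (e 0 (suc n)) (diag-zero _ (λ a b → e (suc a) b) n)) (+-identityʳ 0#)

  diag-sum : ∀ T n → diag T n ≈ sumTo (suc n) (λ a → T a (n ∸ a))
  diag-sum T zero    = sym (+-identityˡ _)
  diag-sum T (suc n) = trans (+-congˡ (diag-sum (λ a b → T (suc a) b) n))
                             (sym (sum-first (suc n) (λ a → T a (suc n ∸ a))))

  diag-last : ∀ T n → diag T (suc n) ≈ diag (λ a b → T a (suc b)) n + T (suc n) 0
  diag-last T zero    = refl
  diag-last T (suc n) = trans (+-congˡ (diag-last (λ a b → T (suc a) b) n)) (sym (+-assoc _ _ _))

  diag-transpose : ∀ T → diag T ≋ diag (λ a b → T b a)
  diag-transpose T zero    = refl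
  diag-transpose T (suc n) = trans (+-congˡ (diag-transpose (λ a b → T (suc a) b) n))
                               (trans (+-comm _ _) (sym (diag-last (λ a b → T b a) n)))

  -- Multiplying a double series by the first / second variable.
  shA : Arr → Arr
  shA T zero    b = 0#
  shA T (suc a) b = T a b

  shB : Arr → Arr
  shB T a zero    = 0#
  shB T a (suc b) = T a b

  diag-shA : ∀ T → diag (shA T) ≋ sh (diag T)
  diag-shA T zero    = refl
  diag-shA T (suc n) = +-identityˡ _

  diag-shB : ∀ T → diag (shB T) ≋ sh (diag T)
  diag-shB T n = begin
    diag (shB T) n                 ≈⟨ diag-transpose (shB T) n ⟩
    diag (λ a b → shB T b a) n     ≈⟨ diag-cong transposed n ⟩
    diag (shA (λ a b → T b a)) n   ≈⟨ diag-shA (λ a b → T b a) n ⟩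
    sh (diag (λ a b → T b a)) n    ≈⟨ sh-cong (≋-sym (diag-transpose T)) n ⟩
    sh (diag T) n                  ∎
    where
    transposed : ∀ a b → shB T b a ≈ shA (λ a b → T b a) a b
    transposed zero    b = refl
    transposed (suc a) b = refl

  ⋆-cong : ∀ {f f' g g'} → f ≋ f' → g ≋ g' → f ⋆ g ≋ f' ⋆ g'
  ⋆-cong e e' = diag-cong (λ a b → *-cong (e a) (e' b))

  ⋆-congˡ : ∀ {f g} h → f ≋ g → h ⋆ f ≋ h ⋆ g
  ⋆-congˡ h e = ⋆-cong ≋-refl e

  ⋆-congʳ : ∀ {f g} h → f ≋ g → f ⋆ h ≋ g ⋆ h
  ⋆-congʳ h e = ⋆-cong e ≋-refl

  ⋆-comm : ∀ f g → f ⋆ g ≋ g ⋆ f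
  ⋆-comm f g n = trans (diag-transpose _ n) (diag-cong (λ a b → *-comm (f b) (g a)) n)

  ⋆-distribʳ : ∀ f g h → (f ⊕ g) ⋆ h ≋ f ⋆ h ⊕ g ⋆ h
  ⋆-distribʳ f g h n = trans (diag-cong (λ a b → distribʳ (h b) (f a) (g a)) n) (diag-+ _ _ n)

  ⋆-·ˡ : ∀ x f g → (x · f) ⋆ g ≋ x · (f ⋆ g)
  ⋆-·ˡ x f g n = trans (diag-cong (λ a b → *-assoc x (f a) (g b)) n) (diag-* x _ n)

  δ⋆ : ∀ f → δ ⋆ f ≋ f
  δ⋆ f zero    = *-identityˡ _
  δ⋆ f (suc n) = trans (+-cong (*-identityˡ _) (diag-zero _ (λ a b → zeroˡ (f b)) n)) (+-identityʳ _)

  sh⋆ : ∀ f g → sh f ⋆ g ≋ sh (f ⋆ g)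
  sh⋆ f g zero    = zeroˡ _
  sh⋆ f g (suc n) = trans (+-congʳ (zeroˡ _)) (+-identityˡ _)

  ⋆-assoc : ∀ f g h → (f ⋆ g) ⋆ h ≋ f ⋆ (g ⋆ h)
  ⋆-assoc f g h zero    = *-assoc _ _ _
  ⋆-assoc f g h (suc n) = begin
    (f 0 * g 0) * h (suc n) + diag (λ a b → (f ⋆ g) (suc a) * h b) n
      ≈⟨ +-congˡ (diag-cong (λ a b → distribʳ (h b) (f 0 * g (suc a)) ((f' ⋆ g) a)) n) ⟩
    (f 0 * g 0) * h (suc n) + diag (λ a b → (f 0 * g (suc a)) * h b + (f' ⋆ g) a * h b) n
      ≈⟨ +-congˡ (diag-+ _ _ n) ⟩
    (f 0 * g 0) * h (suc n) + (diag (λ a b → (f 0 * g (suc a)) * h b) n + ((f' ⋆ g) ⋆ h) n)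
      ≈⟨ +-congˡ (+-cong (trans (diag-cong (λ a b → *-assoc _ _ _) n) (diag-* (f 0) _ n))
                         (⋆-assoc f' g h n)) ⟩
    (f 0 * g 0) * h (suc n) + (f 0 * D + (f' ⋆ (g ⋆ h)) n)
      ≈⟨ solve 5 (λ a b c d e → (a :* b) :* c :+ (a :* d :+ e) := a :* (b :* c :+ d) :+ e)
                 refl (f 0) (g 0) (h (suc n)) D _ ⟩
    f 0 * (g 0 * h (suc n) + D) + (f' ⋆ (g ⋆ h)) n  ∎
    where
    f' = λ a → f (suc a)
    D = diag (λ a b → g (suc a) * h b) n

  ⋆-left-comm : ∀ f g h → f ⋆ (g ⋆ h) ≋ g ⋆ (f ⋆ h)
  ⋆-left-comm f g h =
    ≋-trans (≋-sym (⋆-assoc f g h)) (≋-trans (⋆-congʳ h (⋆-comm f g)) (⋆-assoc g f h))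

  ⋆-identityʳ : ∀ f → f ⋆ δ ≋ f
  ⋆-identityʳ f = ≋-trans (⋆-comm f δ) (δ⋆ f)

  -- Series under _⋆_ form a commutative monoid; this gives equational
  -- reasoning for _≋_ and the commutative-monoid solver of the library.
  ⋆-commutativeMonoid : CommutativeMonoid c ℓ
  ⋆-commutativeMonoid = record
    { Carrier = Seq ; _≈_ = _≋_ ; _∙_ = _⋆_ ; ε = δ
    ; isCommutativeMonoid = record
      { isMonoid = record
        { isSemigroup = record
          { isMagma = record
            { isEquivalence = record { refl = ≋-refl ; sym = ≋-sym ; trans = ≋-trans }
            ; ∙-cong = ⋆-cong }
          ; assoc = ⋆-assoc }
        ; identity = δ⋆ , ⋆-identityʳ }
      ; comm = ⋆-comm } }

  -- The linear factors 1 + xz and 1 - xz².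
  lin : Carrier → Seq
  lin x = δ ⊕ x · sh δ

  lin² : Carrier → Seq
  lin² x = δ ⊕ (- x) · sh (sh δ)

  lin-cong : ∀ {x y} → x ≈ y → lin x ≋ lin y
  lin-cong e n = +-congˡ (*-congʳ e)

  lin⋆ : ∀ x f → lin x ⋆ f ≋ f ⊕ x · sh f
  lin⋆ x f n = trans (⋆-distribʳ _ _ f n)
    (+-cong (δ⋆ f n) (trans (⋆-·ˡ x _ f n) (*-congˡ (trans (sh⋆ δ f n) (sh-cong (δ⋆ f) n)))))

  lin²⋆ : ∀ x f → lin² x ⋆ f ≋ f ⊕ (- x) · sh (sh f)
  lin²⋆ x f n = trans (⋆-distribʳ _ _ f n)
    (+-cong (δ⋆ f n) (trans (⋆-·ˡ (- x) _ f n)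
      (*-congˡ (trans (sh⋆ (sh δ) f n) (sh-cong (λ m → trans (sh⋆ δ f m) (sh-cong (δ⋆ f) m)) n)))))

  -- A coefficientwise recurrence between double series T and T' lifts to
  -- the identity (1 - u z²) · diag T = (1 + p z) · diag T'.
  lift-recurrence : ∀ u p T T' F → (∀ a b → T a b + (- u) * shA (shB T) a b ≈ T' a b + p * F a b) →
                    diag F ≋ sh (diag T') → lin² u ⋆ diag T ≋ lin p ⋆ diag T'
  lift-recurrence u p T T' F rec F≋ s = begin
    (lin² u ⋆ diag T) s                               ≈⟨ lin²⋆ u (diag T) s ⟩
    diag T s + (- u) * sh (sh (diag T)) s             ≈⟨ +-congˡ (*-congˡ (shifted s)) ⟨
    diag T s + (- u) * diag (shA (shB T)) s           ≈⟨ diag-lin T (shA (shB T)) (- u) s ⟨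
    diag (λ a b → T a b + (- u) * shA (shB T) a b) s  ≈⟨ diag-cong rec s ⟩
    diag (λ a b → T' a b + p * F a b) s               ≈⟨ diag-lin T' F p s ⟩
    diag T' s + p * diag F s                          ≈⟨ +-congˡ (*-congˡ (F≋ s)) ⟩
    diag T' s + p * sh (diag T') s                    ≈⟨ lin⋆ p (diag T') s ⟨
    (lin p ⋆ diag T') s                               ∎
    where
    shifted : diag (shA (shB T)) ≋ sh (sh (diag T))
    shifted n = trans (diag-shA (shB T) n) (sh-cong (diag-shB T) n)

module QProducts {c ℓ : Level} (R : CommutativeRing c ℓ) where
  open CommutativeRing R hiding (zero)
  open Series R
  open Basics R
  open FormalSeries R
  open Arithmetic using (tri)
  open import Relation.Binary.Reasoning.Setoid setoid

  -- prod b x N = (-xz; b)_N = ∏_{i<N} (1 + x bⁱ z)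
  prod : Carrier → Carrier → ℕ → Seq
  prod b x zero    = δ
  prod b x (suc N) = prod b x N ⋆ lin (x * pow b N)

  prod-cong : ∀ b {x y} N → x ≈ y → prod b x N ≋ prod b y N
  prod-cong b zero    e = ≋-refl
  prod-cong b (suc N) e = ⋆-cong (prod-cong b N e) (lin-cong (*-congʳ e))

  q-binomial : ∀ b x N m → prod b x N m ≈ pow b (tri m) * pow x m * gauss b N m
  q-binomial b x zero    zero    = sym (trans (*-identityʳ _) (*-identityʳ _))
  q-binomial b x zero    (suc m) = sym (zeroʳ _)
  q-binomial b x (suc N) m = trans (⋆-comm _ _ m) (trans (lin⋆ (x * pow b N) (prod b x N) m) (step m))
    where
    step : ∀ m → prod b x N m + (x * pow b N) * sh (prod b x N) m ≈ pow b (tri m) * pow x m * gauss b (suc N) m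
    step zero    = begin
      prod b x N 0 + (x * pow b N) * 0#  ≈⟨ +-cong (q-binomial b x N 0) (zeroʳ _) ⟩
      1# * 1# * gauss b N 0 + 0#         ≈⟨ +-identityʳ _ ⟩
      1# * 1# * gauss b N 0              ≈⟨ *-congˡ (gauss-zero b N) ⟩
      1# * 1# * 1#                       ∎
    step (suc m) = begin
      prod b x N (suc m) + (x * pow b N) * prod b x N m
        ≈⟨ +-cong (trans (q-binomial b x N (suc m)) (*-congʳ (*-congʳ (pow-+ b (tri m) m))))
                  (*-congˡ (q-binomial b x N m)) ⟩
      Tm * Bm * (x * Xm) * A + (x * pow b N) * (Tm * Xm * G)
        ≈⟨ +-congˡ (solve 5 (λ x p T X G → (x :* p) :* (T :* X :* G) := G :* (p :* (T :* X :* x))) refl x _ Tm Xm G) ⟩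
      Tm * Bm * (x * Xm) * A + G * (pow b N * (Tm * Xm * x))
        ≈⟨ +-congˡ (gauss-guard b N m (λ m≤N → *-congʳ (split m≤N))) ⟩
      Tm * Bm * (x * Xm) * A + G * ((Bm * Dm) * (Tm * Xm * x))
        ≈⟨ solve 7 (λ T B x X A D G → T :* B :* (x :* X) :* A :+ G :* ((B :* D) :* (T :* X :* x))
                                    := T :* B :* (x :* X) :* (A :+ D :* G)) refl Tm Bm x Xm A Dm G ⟩
      Tm * Bm * (x * Xm) * (A + Dm * G)
        ≈⟨ *-cong (*-congʳ (sym (pow-+ b (tri m) m))) (sym (gauss-pascal′ b N m)) ⟩
      pow b (tri m ℕ.+ m) * (x * Xm) * gauss b (suc N) (suc m)  ∎
      where
      Tm = pow b (tri m)
      Bm = pow b m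
      Dm = pow b (N ∸ m)
      Xm = pow x m
      A = gauss b N (suc m)
      G = gauss b N m
      split : m ≤ N → pow b N ≈ Bm * Dm
      split m≤N = trans (pow-≡ b (≡.sym (ℕP.m+[n∸m]≡n m≤N))) (pow-+ b m (N ∸ m))

  -- even f = Σ_k f k z^(2k)
  even : (ℕ → Carrier) → Seq
  even f zero          = f 0
  even f (suc zero)    = 0#
  even f (suc (suc s)) = even (λ k → f (suc k)) s

  even-cong : ∀ {f g} → (∀ k → f k ≈ g k) → even f ≋ even g
  even-cong e zero          = e 0
  even-cong e (suc zero)    = refl
  even-cong e (suc (suc s)) = even-cong (λ k → e (suc k)) s

  even-lin : ∀ f g x → even f ⊕ x · even g ≋ even (λ k → f k + x * g k)
  even-lin f g x zero          = refl
  even-lin f g x (suc zero)    = trans (+-congˡ (zeroʳ x)) (+-identityʳ _)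
  even-lin f g x (suc (suc s)) = even-lin (λ k → f (suc k)) (λ k → g (suc k)) x s

  even-zero : ∀ f → (∀ k → f k ≈ 0#) → even f ≋ (λ _ → 0#)
  even-zero f e zero          = e 0
  even-zero f e (suc zero)    = refl
  even-zero f e (suc (suc s)) = even-zero _ (λ k → e (suc k)) s

  even-at-even : ∀ f k → even f (k ℕ.* 2) ≈ f k
  even-at-even f zero    = refl
  even-at-even f (suc k) = even-at-even (λ j → f (suc j)) k

  even-at-odd : ∀ f k → even f (suc (k ℕ.* 2)) ≈ 0#
  even-at-odd f zero    = refl
  even-at-odd f (suc k) = even-at-odd (λ j → f (suc j)) k

  -- prod² b N = (z²; b)_N = ∏_{i<N} (1 - bⁱ z²)
  prod² : Carrier → ℕ → Seq
  prod² b zero    = δ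
  prod² b (suc N) = prod² b N ⋆ lin² (pow b N)

  -- prod²⁻¹ b N = Σ_k [N + k, k]_b z^(2k), the inverse of (z²; b)_(N+1)
  prod²⁻¹ : Carrier → ℕ → Seq
  prod²⁻¹ b N = even (λ k → gauss b (N ℕ.+ k) k)

  -- 1/(z²; b)_(N+1) = (1 - b^(N+1) z²)/(z²; b)_(N+2), coefficientwise by q-Pascal.
  prod²⁻¹-step : ∀ b N → lin² (pow b (suc N)) ⋆ prod²⁻¹ b (suc N) ≋ prod²⁻¹ b N
  prod²⁻¹-step b N s = trans (lin²⁻¹⋆ s) (coeff s)
    where
    lin²⁻¹⋆ = lin²⋆ (pow b (suc N)) (prod²⁻¹ b (suc N))
    pascal : ∀ k → gauss b (suc N ℕ.+ suc k) (suc k) + (- pow b (suc N)) * gauss b (suc N ℕ.+ k) k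
                   ≈ gauss b (N ℕ.+ suc k) (suc k)
    pascal k = begin
      gauss b (suc N ℕ.+ suc k) (suc k) + (- pow b (suc N)) * G₀
        ≡⟨ ≡.cong (λ n → gauss b n (suc k) + (- pow b (suc N)) * G₀) (ℕP.+-suc (suc N) k) ⟩
      gauss b (suc (suc N ℕ.+ k)) (suc k) + (- pow b (suc N)) * G₀
        ≈⟨ +-congʳ (gauss-pascal′ b (suc N ℕ.+ k) k) ⟩
      (G₁ + pow b (suc N ℕ.+ k ∸ k) * G₀) + (- pow b (suc N)) * G₀
        ≈⟨ +-congʳ (+-congˡ (*-congʳ (pow-≡ b (ℕP.m+n∸n≡m (suc N) k)))) ⟩
      (G₁ + pow b (suc N) * G₀) + (- pow b (suc N)) * G₀
        ≈⟨ +-*-cancel G₁ (pow b (suc N)) G₀ ⟩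
      G₁
        ≡⟨ ≡.cong (λ n → gauss b n (suc k)) (≡.sym (ℕP.+-suc N k)) ⟩
      gauss b (N ℕ.+ suc k) (suc k)  ∎
      where
      G₁ = gauss b (suc N ℕ.+ k) (suc k)
      G₀ = gauss b (suc N ℕ.+ k) k
    coeff : ∀ s → prod²⁻¹ b (suc N) s + (- pow b (suc N)) * sh (sh (prod²⁻¹ b (suc N))) s ≈ prod²⁻¹ b N s
    coeff zero          = trans (+-congˡ (zeroʳ _))
                            (trans (+-identityʳ _) (trans (gauss-zero b (suc N ℕ.+ 0)) (sym (gauss-zero b (N ℕ.+ 0)))))
    coeff (suc zero)    = trans (+-congˡ (zeroʳ _)) (+-identityʳ _)
    coeff (suc (suc s)) = trans (even-lin _ _ _ s) (even-cong pascal s)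

  prod²-inverse : ∀ b N → prod² b (suc N) ⋆ prod²⁻¹ b N ≋ δ
  prod²-inverse b zero s = begin
    ((δ ⋆ lin² (pow b 0)) ⋆ prod²⁻¹ b 0) s  ≈⟨ ⋆-congʳ (prod²⁻¹ b 0) (δ⋆ (lin² (pow b 0))) s ⟩
    (lin² 1# ⋆ prod²⁻¹ b 0) s               ≈⟨ lin²⋆ 1# (prod²⁻¹ b 0) s ⟩
    prod²⁻¹ b 0 s + (- 1#) * sh (sh (prod²⁻¹ b 0)) s ≈⟨ coeff s ⟩
    δ s                                     ∎
    where
    coeff : ∀ s → prod²⁻¹ b 0 s + (- 1#) * sh (sh (prod²⁻¹ b 0)) s ≈ δ s
    coeff zero          = trans (+-congˡ (zeroʳ _)) (+-identityʳ _)
    coeff (suc zero)    = trans (+-congˡ (zeroʳ _)) (+-identityʳ _)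
    coeff (suc (suc s)) = trans (even-lin _ _ _ s) (even-zero _ cancel s)
      where
      cancel : ∀ k → gauss b (suc k) (suc k) + (- 1#) * gauss b k k ≈ 0#
      cancel k = begin
        gauss b (suc k) (suc k) + (- 1#) * gauss b k k ≈⟨ +-cong (gauss-diag b (suc k)) (*-congˡ (gauss-diag b k)) ⟩
        1# + (- 1#) * 1#                               ≈⟨ +-congˡ (*-identityʳ _) ⟩
        1# + - 1#                                      ≈⟨ -‿inverseʳ 1# ⟩
        0#                                             ∎
  prod²-inverse b (suc N) s = begin
    ((prod² b (suc N) ⋆ lin² (pow b (suc N))) ⋆ prod²⁻¹ b (suc N)) s  ≈⟨ ⋆-assoc _ _ _ s ⟩
    (prod² b (suc N) ⋆ (lin² (pow b (suc N)) ⋆ prod²⁻¹ b (suc N))) s  ≈⟨ ⋆-congˡ _ (prod²⁻¹-step b N) s ⟩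
    (prod² b (suc N) ⋆ prod²⁻¹ b N) s                                ≈⟨ prod²-inverse b N s ⟩
    δ s                                                              ∎

-- The double series S m n = Σ_{a,b} q^(3j²+j) [m+b, a]_Q [n+a, b]_Q z^(a+b),
-- j = b - a, Q = q⁶ (as a double sequence t m n, summed along anti-diagonals),
-- its value at m = n = 0, and the two recurrences in m and n from which its
-- product formula follows (ProductFormulas.S-product).
module DoubleSeries {c ℓ : Level} (R : CommutativeRing c ℓ) (q : CommutativeRing.Carrier R) where
  open CommutativeRing R hiding (zero)
  open Series R
  open Basics R
  open FormalSeries R
  open QProducts R
  open Arithmetic using (ex; ex-diag; ex-stepˡ; ex-stepʳ; shift-exp; shift-exp₀; sum-of-gaps; double≢odd; even-or-odd)
  open import Relation.Binary.Reasoning.Setoid setoid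

  Q : Carrier
  Q = pow q 6

  t : ℕ → ℕ → Arr
  t m n a b = pow q (ex a b) * gauss Q (m ℕ.+ b) a * gauss Q (n ℕ.+ a) b

  S : ℕ → ℕ → Seq
  S m n = diag (t m n)

  pow-q-Q : ∀ e k e₁ e₂ → e ℕ.+ 6 ℕ.* k ≡ e₁ ℕ.+ e₂ → pow q e * pow Q k ≈ pow q e₁ * pow q e₂
  pow-q-Q e k e₁ e₂ h = begin
    pow q e * pow Q k          ≈⟨ *-congˡ (pow-* q 6 k) ⟨
    pow q e * pow q (6 ℕ.* k)  ≈⟨ pow-+ q e (6 ℕ.* k) ⟨
    pow q (e ℕ.+ 6 ℕ.* k)      ≡⟨ ≡.cong (pow q) h ⟩
    pow q (e₁ ℕ.+ e₂)          ≈⟨ pow-+ q e₁ e₂ ⟩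
    pow q e₁ * pow q e₂        ∎

  pow-Q-Q : ∀ d₁ d₂ d → d₁ ℕ.+ d₂ ≡ d → pow Q d₁ * pow Q d₂ ≈ pow Q d
  pow-Q-Q d₁ d₂ d h = trans (sym (pow-+ Q d₁ d₂)) (pow-≡ Q h)

  pow-split : ∀ r m → pow q (6 ℕ.* m ℕ.+ r) ≈ pow q r * pow Q m
  pow-split r m = trans (pow-≡ q (ℕP.+-comm (6 ℕ.* m) r)) (trans (pow-+ q r (6 ℕ.* m)) (*-congˡ (pow-* q 6 m)))

  gauss-≡ : ∀ {n n'} k → n ≡ n' → gauss Q n k ≈ gauss Q n' k
  gauss-≡ k h = reflexive (≡.cong (λ n → gauss Q n k) h)

  -- The recurrence raising m, at the coefficient of z_a^a z_b^b:
  --   t(m+1, n) - Q^(m+n+1) z_a z_b t(m+1, n) = t(m, n) + q^(6m+2) z_a t(m, n).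
  Recₘ : ℕ → ℕ → ℕ → ℕ → Set ℓ
  Recₘ m n a b = t (suc m) n a b + (- pow Q (suc (m ℕ.+ n))) * shA (shB (t (suc m) n)) a b
                 ≈ t m n a b + pow q (6 ℕ.* m ℕ.+ 2) * shA (t m n) a b

  -- a = 0: both shifted terms vanish and [m+b, 0] = 1.
  recₘ-row₀ : ∀ m n b → Recₘ m n 0 b
  recₘ-row₀ m n b = begin
    t (suc m) n 0 b + Qᵐⁿ * 0#               ≈⟨ trans (+-congˡ (zeroʳ _)) (+-identityʳ _) ⟩
    pow q (ex 0 b) * gauss Q (suc m ℕ.+ b) 0 * B
      ≈⟨ *-congʳ (*-congˡ (trans (gauss-zero Q (suc m ℕ.+ b)) (sym (gauss-zero Q (m ℕ.+ b))))) ⟩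
    t m n 0 b                                ≈⟨ trans (+-congˡ (zeroʳ _)) (+-identityʳ _) ⟨
    t m n 0 b + pow q (6 ℕ.* m ℕ.+ 2) * 0#   ∎
    where
    Qᵐⁿ = - pow Q (suc (m ℕ.+ n))
    B = gauss Q (n ℕ.+ 0) b

  -- b = 0: one application of q-Pascal to [m+1, a+1].
  recₘ-column₀ : ∀ m n a → Recₘ m n (suc a) 0
  recₘ-column₀ m n a = begin
    e * gauss Q (suc (m ℕ.+ 0)) (suc a) * o + Qᵐⁿ * 0#
      ≈⟨ trans (+-congˡ (zeroʳ _)) (+-identityʳ _) ⟩
    e * gauss Q (suc (m ℕ.+ 0)) (suc a) * o
      ≈⟨ *-congʳ (*-congˡ (gauss-pascal′ Q (m ℕ.+ 0) a)) ⟩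
    e * (U + P * G) * o
      ≈⟨ solve 5 (λ e U P G o → e :* (U :+ P :* G) :* o := e :* U :* o :+ G :* ((e :* P) :* o)) refl e U P G o ⟩
    e * U * o + G * ((e * P) * o)
      ≈⟨ +-congˡ (gauss-guard Q (m ℕ.+ 0) a (λ a≤ → *-cong (exponent a≤) o≈o')) ⟩
    e * U * o + G * ((p * e') * o')
      ≈⟨ +-congˡ (solve 4 (λ G p e' o' → G :* ((p :* e') :* o') := p :* (e' :* G :* o')) refl G p e' o') ⟩
    e * U * o + p * (e' * G * o')  ∎
    where
    Qᵐⁿ = - pow Q (suc (m ℕ.+ n))
    e = pow q (ex (suc a) 0)
    e' = pow q (ex a 0)
    p = pow q (6 ℕ.* m ℕ.+ 2)
    U = gauss Q (m ℕ.+ 0) (suc a)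
    G = gauss Q (m ℕ.+ 0) a
    P = pow Q ((m ℕ.+ 0) ∸ a)
    o = gauss Q (n ℕ.+ suc a) 0
    o' = gauss Q (n ℕ.+ a) 0
    o≈o' : o ≈ o'
    o≈o' = trans (gauss-zero Q (n ℕ.+ suc a)) (sym (gauss-zero Q (n ℕ.+ a)))
    exponent : a ≤ m ℕ.+ 0 → e * P ≈ p * e'
    exponent a≤ = pow-q-Q (ex (suc a) 0) ((m ℕ.+ 0) ∸ a) (6 ℕ.* m ℕ.+ 2) (ex a 0)
                    (shift-exp₀ (ex (suc a) 0) (ex a 0) a 2 _ m (ex-stepˡ a 0) (ℕP.m+[n∸m]≡n a≤))

  -- a, b > 0: q-Pascal in both binomials; the cross terms cancel since
  -- Q^(m+b+1-a) Q^(n+a-b) = Q^(m+n+1).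
  recₘ-interior : ∀ m n a b → Recₘ m n (suc a) (suc b)
  recₘ-interior m n a b = begin
    e * gauss Q (suc (m ℕ.+ suc b)) (suc a) * gauss Q (n ℕ.+ suc a) (suc b)
      + Qᵐⁿ * (e * gauss Q (suc (m ℕ.+ b)) a * Y)
      ≈⟨ +-cong (*-cong (*-congˡ (gauss-pascal′ Q (m ℕ.+ suc b) a)) pascalₙ)
                (*-congˡ (*-congʳ (*-congˡ (gauss-≡ a (≡.sym (ℕP.+-suc m b)))))) ⟩
    e * (U + P₁ * V) * (Z + P₂ * Y) + Qᵐⁿ * (e * V * Y)
      ≈⟨ +-congʳ (solve 7 (λ e U P₁ V Z P₂ Y → e :* (U :+ P₁ :* V) :* (Z :+ P₂ :* Y)
                     := (e :* U :* (Z :+ P₂ :* Y) :+ V :* (Z :* (e :* P₁))) :+ V :* (Y :* ((P₁ :* P₂) :* e)))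
                     refl e U P₁ V Z P₂ Y) ⟩
    ((e * U * (Z + P₂ * Y) + V * (Z * (e * P₁))) + V * (Y * ((P₁ * P₂) * e))) + Qᵐⁿ * (e * V * Y)
      ≈⟨ +-congʳ (+-cong (+-congˡ (gauss-guard Q (m ℕ.+ suc b) a (λ a≤ → *-congˡ (exponent a≤))))
                         (gauss-guard Q (m ℕ.+ suc b) a (λ a≤ → gauss-guard Q (n ℕ.+ a) b (λ b≤ →
                            *-congʳ (pow-Q-Q ((m ℕ.+ suc b) ∸ a) ((n ℕ.+ a) ∸ b) _ (gaps a≤ b≤)))))) ⟩
    ((e * U * (Z + P₂ * Y) + V * (Z * (p * e'))) + V * (Y * (pow Q (suc (m ℕ.+ n)) * e))) + Qᵐⁿ * (e * V * Y)
      ≈⟨ +-congʳ (solve 9 (λ e U Z P₂ Y V p e' c → (e :* U :* (Z :+ P₂ :* Y) :+ V :* (Z :* (p :* e'))) :+ V :* (Y :* (c :* e))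
                     := (e :* U :* (Z :+ P₂ :* Y) :+ p :* (e' :* V :* Z)) :+ c :* (e :* V :* Y))
                     refl e U Z P₂ Y V p e' (pow Q (suc (m ℕ.+ n)))) ⟩
    ((e * U * (Z + P₂ * Y) + p * (e' * V * Z)) + pow Q (suc (m ℕ.+ n)) * (e * V * Y)) + Qᵐⁿ * (e * V * Y)
      ≈⟨ +-*-cancel _ (pow Q (suc (m ℕ.+ n))) _ ⟩
    e * U * (Z + P₂ * Y) + p * (e' * V * Z)
      ≈⟨ +-congʳ (*-congˡ pascalₙ) ⟨
    e * U * gauss Q (n ℕ.+ suc a) (suc b) + p * (e' * V * Z)  ∎
    where
    Qᵐⁿ = - pow Q (suc (m ℕ.+ n))
    e = pow q (ex a b)
    e' = pow q (ex a (suc b))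
    p = pow q (6 ℕ.* m ℕ.+ 2)
    U = gauss Q (m ℕ.+ suc b) (suc a)
    V = gauss Q (m ℕ.+ suc b) a
    Z = gauss Q (n ℕ.+ a) (suc b)
    Y = gauss Q (n ℕ.+ a) b
    P₁ = pow Q ((m ℕ.+ suc b) ∸ a)
    P₂ = pow Q ((n ℕ.+ a) ∸ b)
    pascalₙ : gauss Q (n ℕ.+ suc a) (suc b) ≈ Z + P₂ * Y
    pascalₙ = trans (gauss-≡ (suc b) (ℕP.+-suc n a)) (gauss-pascal′ Q (n ℕ.+ a) b)
    exponent : a ≤ m ℕ.+ suc b → e * P₁ ≈ p * e'
    exponent a≤ = pow-q-Q (ex a b) ((m ℕ.+ suc b) ∸ a) (6 ℕ.* m ℕ.+ 2) (ex a (suc b))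
                    (shift-exp (ex a b) (ex a (suc b)) b a 4 2 _ m (ex-stepʳ a b) (ℕP.m+[n∸m]≡n a≤) ≡.refl)
    gaps : a ≤ m ℕ.+ suc b → b ≤ n ℕ.+ a → ((m ℕ.+ suc b) ∸ a) ℕ.+ ((n ℕ.+ a) ∸ b) ≡ suc (m ℕ.+ n)
    gaps a≤ b≤ = sum-of-gaps a b _ _ _ _ _ (ℕP.m+[n∸m]≡n a≤) (ℕP.m+[n∸m]≡n b≤) (total m n a b)
      where
      total : ∀ m n a b → (m ℕ.+ suc b) ℕ.+ (n ℕ.+ a) ≡ suc (m ℕ.+ n) ℕ.+ (a ℕ.+ b)
      total = solve-∀

  recₘ : ∀ m n a b → Recₘ m n a b
  recₘ m n zero    b       = recₘ-row₀ m n b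
  recₘ m n (suc a) zero    = recₘ-column₀ m n a
  recₘ m n (suc a) (suc b) = recₘ-interior m n a b

  -- The recurrence raising n, at the coefficient of z_a^a z_b^b:
  --   t(m, n+1) - Q^(m+n+1) z_a z_b t(m, n+1) = t(m, n) + q^(6n+4) z_b t(m, n).
  Recₙ : ℕ → ℕ → ℕ → ℕ → Set ℓ
  Recₙ m n a b = t m (suc n) a b + (- pow Q (suc (m ℕ.+ n))) * shA (shB (t m (suc n))) a b
                 ≈ t m n a b + pow q (6 ℕ.* n ℕ.+ 4) * shB (t m n) a b

  -- b = 0: both shifted terms vanish and [n+a, 0] = 1.
  recₙ-column₀ : ∀ m n a →
                 t m (suc n) a 0 + (- pow Q (suc (m ℕ.+ n))) * 0# ≈ t m n a 0 + pow q (6 ℕ.* n ℕ.+ 4) * 0#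
  recₙ-column₀ m n a = begin
    t m (suc n) a 0 + (- pow Q (suc (m ℕ.+ n))) * 0#  ≈⟨ trans (+-congˡ (zeroʳ _)) (+-identityʳ _) ⟩
    t m (suc n) a 0
      ≈⟨ *-congˡ (trans (gauss-zero Q (suc n ℕ.+ a)) (sym (gauss-zero Q (n ℕ.+ a)))) ⟩
    t m n a 0                                         ≈⟨ trans (+-congˡ (zeroʳ _)) (+-identityʳ _) ⟨
    t m n a 0 + pow q (6 ℕ.* n ℕ.+ 4) * 0#            ∎

  -- a = 0: one application of q-Pascal to [n+1, b+1].
  recₙ-row₀ : ∀ m n b → Recₙ m n 0 (suc b)
  recₙ-row₀ m n b = begin
    e * o * gauss Q (suc (n ℕ.+ 0)) (suc b) + Qᵐⁿ * 0#
      ≈⟨ trans (+-congˡ (zeroʳ _)) (+-identityʳ _) ⟩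
    e * o * gauss Q (suc (n ℕ.+ 0)) (suc b)
      ≈⟨ *-congˡ (gauss-pascal′ Q (n ℕ.+ 0) b) ⟩
    e * o * (X + P * Y)
      ≈⟨ solve 5 (λ e o X P Y → e :* o :* (X :+ P :* Y) := e :* o :* X :+ Y :* ((e :* P) :* o)) refl e o X P Y ⟩
    e * o * X + Y * ((e * P) * o)
      ≈⟨ +-congˡ (gauss-guard Q (n ℕ.+ 0) b (λ b≤ → *-cong (exponent b≤) o≈o')) ⟩
    e * o * X + Y * ((p * e') * o')
      ≈⟨ +-congˡ (solve 4 (λ Y p e' o' → Y :* ((p :* e') :* o') := p :* (e' :* o' :* Y)) refl Y p e' o') ⟩
    e * o * X + p * (e' * o' * Y)  ∎
    where
    Qᵐⁿ = - pow Q (suc (m ℕ.+ n))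
    e = pow q (ex 0 (suc b))
    e' = pow q (ex 0 b)
    p = pow q (6 ℕ.* n ℕ.+ 4)
    o = gauss Q (m ℕ.+ suc b) 0
    o' = gauss Q (m ℕ.+ b) 0
    X = gauss Q (n ℕ.+ 0) (suc b)
    Y = gauss Q (n ℕ.+ 0) b
    P = pow Q ((n ℕ.+ 0) ∸ b)
    o≈o' : o ≈ o'
    o≈o' = trans (gauss-zero Q (m ℕ.+ suc b)) (sym (gauss-zero Q (m ℕ.+ b)))
    exponent : b ≤ n ℕ.+ 0 → e * P ≈ p * e'
    exponent b≤ = pow-q-Q (ex 0 (suc b)) ((n ℕ.+ 0) ∸ b) (6 ℕ.* n ℕ.+ 4) (ex 0 b)
                    (shift-exp₀ (ex 0 (suc b)) (ex 0 b) b 4 _ n (ex-stepʳ 0 b) (ℕP.m+[n∸m]≡n b≤))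

  -- a, b > 0: q-Pascal in both binomials; the cross terms cancel since
  -- Q^(m+b-a) Q^(n+a+1-b) = Q^(m+n+1).
  recₙ-interior : ∀ m n a b → Recₙ m n (suc a) (suc b)
  recₙ-interior m n a b = begin
    e * gauss Q (m ℕ.+ suc b) (suc a) * gauss Q (suc (n ℕ.+ suc a)) (suc b)
      + Qᵐⁿ * (e * V * gauss Q (suc (n ℕ.+ a)) b)
      ≈⟨ +-cong (*-cong (*-congˡ pascalₘ) (gauss-pascal′ Q (n ℕ.+ suc a) b))
                (*-congˡ (*-congˡ (gauss-≡ b (≡.sym (ℕP.+-suc n a))))) ⟩
    e * (W + P₁ * V) * (X + P₂ * Y) + Qᵐⁿ * (e * V * Y)
      ≈⟨ +-congʳ (solve 7 (λ e W P₁ V X P₂ Y → e :* (W :+ P₁ :* V) :* (X :+ P₂ :* Y)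
                     := (e :* (W :+ P₁ :* V) :* X :+ Y :* (W :* (e :* P₂))) :+ V :* (Y :* ((P₁ :* P₂) :* e)))
                     refl e W P₁ V X P₂ Y) ⟩
    ((e * (W + P₁ * V) * X + Y * (W * (e * P₂))) + V * (Y * ((P₁ * P₂) * e))) + Qᵐⁿ * (e * V * Y)
      ≈⟨ +-congʳ (+-cong (+-congˡ (gauss-guard Q (n ℕ.+ suc a) b (λ b≤ → *-congˡ (exponent b≤))))
                         (gauss-guard Q (m ℕ.+ b) a (λ a≤ → gauss-guard Q (n ℕ.+ suc a) b (λ b≤ →
                            *-congʳ (pow-Q-Q ((m ℕ.+ b) ∸ a) ((n ℕ.+ suc a) ∸ b) _ (gaps a≤ b≤)))))) ⟩
    ((e * (W + P₁ * V) * X + Y * (W * (p * e'))) + V * (Y * (pow Q (suc (m ℕ.+ n)) * e))) + Qᵐⁿ * (e * V * Y)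
      ≈⟨ +-congʳ (solve 9 (λ e E X Y W V p e' c → (e :* E :* X :+ Y :* (W :* (p :* e'))) :+ V :* (Y :* (c :* e))
                     := (e :* E :* X :+ p :* (e' :* W :* Y)) :+ c :* (e :* V :* Y))
                     refl e (W + P₁ * V) X Y W V p e' (pow Q (suc (m ℕ.+ n)))) ⟩
    ((e * (W + P₁ * V) * X + p * (e' * W * Y)) + pow Q (suc (m ℕ.+ n)) * (e * V * Y)) + Qᵐⁿ * (e * V * Y)
      ≈⟨ +-*-cancel _ (pow Q (suc (m ℕ.+ n))) _ ⟩
    e * (W + P₁ * V) * X + p * (e' * W * Y)
      ≈⟨ +-congʳ (*-congʳ (*-congˡ pascalₘ)) ⟨
    e * gauss Q (m ℕ.+ suc b) (suc a) * X + p * (e' * W * Y)  ∎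
    where
    Qᵐⁿ = - pow Q (suc (m ℕ.+ n))
    e = pow q (ex a b)
    e' = pow q (ex (suc a) b)
    p = pow q (6 ℕ.* n ℕ.+ 4)
    W = gauss Q (m ℕ.+ b) (suc a)
    V = gauss Q (m ℕ.+ b) a
    X = gauss Q (n ℕ.+ suc a) (suc b)
    Y = gauss Q (n ℕ.+ suc a) b
    P₁ = pow Q ((m ℕ.+ b) ∸ a)
    P₂ = pow Q ((n ℕ.+ suc a) ∸ b)
    pascalₘ : gauss Q (m ℕ.+ suc b) (suc a) ≈ W + P₁ * V
    pascalₘ = trans (gauss-≡ (suc a) (ℕP.+-suc m b)) (gauss-pascal′ Q (m ℕ.+ b) a)
    exponent : b ≤ n ℕ.+ suc a → e * P₂ ≈ p * e'
    exponent b≤ = pow-q-Q (ex a b) ((n ℕ.+ suc a) ∸ b) (6 ℕ.* n ℕ.+ 4) (ex (suc a) b)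
                    (shift-exp (ex a b) (ex (suc a) b) a b 2 4 _ n (ex-stepˡ a b) (ℕP.m+[n∸m]≡n b≤) ≡.refl)
    gaps : a ≤ m ℕ.+ b → b ≤ n ℕ.+ suc a → ((m ℕ.+ b) ∸ a) ℕ.+ ((n ℕ.+ suc a) ∸ b) ≡ suc (m ℕ.+ n)
    gaps a≤ b≤ = sum-of-gaps a b _ _ _ _ _ (ℕP.m+[n∸m]≡n a≤) (ℕP.m+[n∸m]≡n b≤) (total m n a b)
      where
      total : ∀ m n a b → (m ℕ.+ b) ℕ.+ (n ℕ.+ suc a) ≡ suc (m ℕ.+ n) ℕ.+ (a ℕ.+ b)
      total = solve-∀

  recₙ : ∀ m n a b → Recₙ m n a b
  recₙ m n zero    zero    = recₙ-column₀ m n 0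
  recₙ m n (suc a) zero    = recₙ-column₀ m n (suc a)
  recₙ m n zero    (suc b) = recₙ-row₀ m n b
  recₙ m n (suc a) (suc b) = recₙ-interior m n a b

  stepₘ : ∀ m n → lin² (pow Q (suc (m ℕ.+ n))) ⋆ S (suc m) n ≋ lin (pow q (6 ℕ.* m ℕ.+ 2)) ⋆ S m n
  stepₘ m n = lift-recurrence _ _ (t (suc m) n) (t m n) (shA (t m n)) (recₘ m n) (diag-shA (t m n))

  stepₙ : ∀ m n → lin² (pow Q (suc (m ℕ.+ n))) ⋆ S m (suc n) ≋ lin (pow q (6 ℕ.* n ℕ.+ 4)) ⋆ S m n
  stepₙ m n = lift-recurrence _ _ (t m (suc n)) (t m n) (shB (t m n)) (recₙ m n) (diag-shB (t m n))

  -- S 0 0 = Σ_k z^(2k) = 1/(1 - z²): only the diagonal a = b contributes.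
  t₀₀-off : ∀ a b → a ≢ b → t 0 0 a b ≈ 0#
  t₀₀-off a b a≢b with ℕP.<-cmp a b
  ... | tri< a<b _ _ = trans (*-congˡ (gauss-> Q a b a<b)) (zeroʳ _)
  ... | tri≈ _ a≡b _ = contradiction a≡b a≢b
  ... | tri> _ _ b<a = trans (*-congʳ (trans (*-congˡ (gauss-> Q b a b<a)) (zeroʳ _))) (zeroˡ _)

  t₀₀-diag : ∀ k → t 0 0 k k ≈ 1#
  t₀₀-diag k = begin
    pow q (ex k k) * gauss Q k k * gauss Q k k  ≈⟨ *-cong (*-cong (pow-≡ q (ex-diag k)) (gauss-diag Q k)) (gauss-diag Q k) ⟩
    1# * 1# * 1#                                ≈⟨ trans (*-identityʳ _) (*-identityʳ _) ⟩
    1#                                          ∎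

  S-base : S 0 0 ≋ prod²⁻¹ Q 0
  S-base s = trans (diag-sum (t 0 0) s) (by-parity (even-or-odd s))
    where
    complement : ∀ {a} → a < suc s → a ℕ.+ (s ∸ a) ≡ s
    complement a< = ℕP.m+[n∸m]≡n (ℕP.≤-pred a<)
    twice : ∀ a → a ℕ.* 2 ≡ a ℕ.+ a
    twice = solve-∀
    by-parity : (∃ λ k → s ≡ k ℕ.* 2) ⊎ (∃ λ k → s ≡ suc (k ℕ.* 2)) →
                sumTo (suc s) (λ a → t 0 0 a (s ∸ a)) ≈ prod²⁻¹ Q 0 s
    by-parity (inj₁ (k , ≡.refl)) = begin
      sumTo (suc s) (λ a → t 0 0 a (s ∸ a))  ≈⟨ sum-single (suc s) k _ (s≤s (ℕP.m≤m*n k 2)) off ⟩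
      t 0 0 k (s ∸ k)                        ≡⟨ ≡.cong (t 0 0 k) half ⟩
      t 0 0 k k                              ≈⟨ t₀₀-diag k ⟩
      1#                                     ≈⟨ trans (even-at-even _ k) (gauss-diag Q k) ⟨
      prod²⁻¹ Q 0 s                          ∎
      where
      half : k ℕ.* 2 ∸ k ≡ k
      half = ≡.trans (≡.cong (_∸ k) (twice k)) (ℕP.m+n∸m≡n k k)
      off : ∀ a → a < suc s → a ≢ k → t 0 0 a (s ∸ a) ≈ 0#
      off a a< a≢k = t₀₀-off a _ (λ e → a≢k (ℕP.*-cancelʳ-≡ a k 2
                       (≡.trans (twice a) (≡.trans (≡.cong (a ℕ.+_) e) (complement a<)))))
    by-parity (inj₂ (k , ≡.refl)) = begin
      sumTo (suc s) (λ a → t 0 0 a (s ∸ a))  ≈⟨ sum-zero (suc s) off ⟩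
      0#                                     ≈⟨ even-at-odd _ k ⟨
      prod²⁻¹ Q 0 s                          ∎
      where
      off : ∀ a → a < suc s → t 0 0 a (s ∸ a) ≈ 0#
      off a a< = t₀₀-off a _ (λ e → double≢odd a k (≡.trans (≡.cong (a ℕ.+_) e) (complement a<)))

-- The product formulas, as identities of power series:
--   (z²; Q)_(m+n+1) · S m n = (-q⁴z; Q)_n · (-q²z; Q)_m,
-- and, with the sign-dependent factors
--   B = (-xz; q²)_(3M),  A = (-yz; Q)_M     ((x, y) = (1, 1) or (q², q⁶)),
-- the identity B / (z²; Q)_(2M+1) = A · S M M, whose z^L coefficients are
-- the two sides of the theorem.
module ProductFormulas {c ℓ : Level} (R : CommutativeRing c ℓ) (q : CommutativeRing.Carrier R) where
  open CommutativeRing R hiding (zero)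
  open Series R
  open Basics R using (pow-≡; pow-+; pow-*)
  open FormalSeries R
  open QProducts R
  open DoubleSeries R q
  open import Relation.Binary.Reasoning.Setoid (CommutativeMonoid.setoid ⋆-commutativeMonoid)
  open import Algebra.Solver.CommutativeMonoid ⋆-commutativeMonoid
    using (solve; _⊜_) renaming (_⊕_ to _⊛_)

  swap-out : ∀ f g h → f ⋆ (g ⋆ h) ≋ (g ⋆ f) ⋆ h
  swap-out = solve 3 (λ f g h → f ⊛ (g ⊛ h) ⊜ (g ⊛ f) ⊛ h) ≋-refl

  rotate : ∀ f g h → f ⋆ (g ⋆ h) ≋ g ⋆ (h ⋆ f)
  rotate = solve 3 (λ f g h → f ⊛ (g ⊛ h) ⊜ g ⊛ (h ⊛ f)) ≋-refl

  S-product : ∀ m n → prod² Q (suc (m ℕ.+ n)) ⋆ S m n ≋ prod Q (pow q 4) n ⋆ prod Q (pow q 2) m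
  S-product zero zero = begin
    prod² Q 1 ⋆ S 0 0           ≈⟨ ⋆-congˡ (prod² Q 1) S-base ⟩
    prod² Q 1 ⋆ prod²⁻¹ Q 0     ≈⟨ prod²-inverse Q 0 ⟩
    δ                           ≈⟨ δ⋆ δ ⟨
    δ ⋆ δ                       ∎
  S-product zero (suc n) = begin
    (prod² Q (suc n) ⋆ lin² (pow Q (suc n))) ⋆ S 0 (suc n)  ≈⟨ ⋆-assoc _ _ _ ⟩
    prod² Q (suc n) ⋆ (lin² (pow Q (suc n)) ⋆ S 0 (suc n))  ≈⟨ ⋆-congˡ (prod² Q (suc n)) (stepₙ 0 n) ⟩
    prod² Q (suc n) ⋆ (lin p ⋆ S 0 n)                       ≈⟨ ⋆-left-comm _ _ _ ⟩
    lin p ⋆ (prod² Q (suc n) ⋆ S 0 n)                       ≈⟨ ⋆-congˡ (lin p) (S-product zero n) ⟩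
    lin p ⋆ (prod Q (pow q 4) n ⋆ δ)                        ≈⟨ swap-out (lin p) (prod Q (pow q 4) n) δ ⟩
    (prod Q (pow q 4) n ⋆ lin p) ⋆ δ                        ≈⟨ ⋆-congʳ δ (⋆-congˡ _ (lin-cong (pow-split 4 n))) ⟩
    prod Q (pow q 4) (suc n) ⋆ δ                            ∎
    where p = pow q (6 ℕ.* n ℕ.+ 4)
  S-product (suc m) n = begin
    (prod² Q (suc (m ℕ.+ n)) ⋆ lin² (pow Q (suc (m ℕ.+ n)))) ⋆ S (suc m) n
                                                   ≈⟨ ⋆-assoc _ _ _ ⟩
    prod² Q (suc (m ℕ.+ n)) ⋆ (lin² (pow Q (suc (m ℕ.+ n))) ⋆ S (suc m) n)
                                                   ≈⟨ ⋆-congˡ (prod² Q (suc (m ℕ.+ n))) (stepₘ m n) ⟩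
    prod² Q (suc (m ℕ.+ n)) ⋆ (lin p ⋆ S m n)      ≈⟨ ⋆-left-comm _ _ _ ⟩
    lin p ⋆ (prod² Q (suc (m ℕ.+ n)) ⋆ S m n)      ≈⟨ ⋆-congˡ (lin p) (S-product m n) ⟩
    lin p ⋆ (prod Q (pow q 4) n ⋆ prod Q (pow q 2) m)
                                                   ≈⟨ rotate (lin p) (prod Q (pow q 4) n) (prod Q (pow q 2) m) ⟩
    prod Q (pow q 4) n ⋆ (prod Q (pow q 2) m ⋆ lin p)
                                                   ≈⟨ ⋆-congˡ _ (⋆-congˡ _ (lin-cong (pow-split 2 m))) ⟩
    prod Q (pow q 4) n ⋆ prod Q (pow q 2) (suc m)  ∎
    where p = pow q (6 ℕ.* m ℕ.+ 2)

  q² : Carrier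
  q² = pow q 2

  q²^3M≈Q^M : ∀ M → pow q² (3 ℕ.* M) ≈ pow Q M
  q²^3M≈Q^M M = trans (sym (pow-* q 2 (3 ℕ.* M))) (trans (pow-≡ q (six M)) (pow-* q 6 M))
    where
    six : ∀ M → 2 ℕ.* (3 ℕ.* M) ≡ 6 ℕ.* M
    six = solve-∀

  -- Regrouping the factors of (-xz; q²)_(3M) by their index mod 3:
  -- (-xz; q²)_(3M) = (-xz; Q)_M (-xq²z; Q)_M (-xq⁴z; Q)_M.
  prod-by-residue : ∀ x M → prod q² x (3 ℕ.* M) ≋ (prod Q x M ⋆ prod Q (x * q²) M) ⋆ prod Q (x * pow q 4) M
  prod-by-residue x zero = begin
    δ                ≈⟨ δ⋆ δ ⟨
    δ ⋆ δ            ≈⟨ ⋆-identityʳ (δ ⋆ δ) ⟨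
    (δ ⋆ δ) ⋆ δ      ∎
  prod-by-residue x (suc M) = begin
    prod q² x (3 ℕ.* suc M)
      ≡⟨ ≡.cong (prod q² x) (3+3M M) ⟩
    ((prod q² x (3 ℕ.* M) ⋆ lin (x * pow q² (3 ℕ.* M))) ⋆ lin (x * (q² * pow q² (3 ℕ.* M))))
      ⋆ lin (x * (q² * (q² * pow q² (3 ℕ.* M))))
      ≈⟨ ⋆-cong (⋆-cong (⋆-cong (prod-by-residue x M) (lin-cong e₀)) (lin-cong e₁)) (lin-cong e₂) ⟩
    ((((Pₓ ⋆ P₂) ⋆ P₄) ⋆ lin (x * pow Q M)) ⋆ lin ((x * q²) * pow Q M)) ⋆ lin ((x * pow q 4) * pow Q M)
      ≈⟨ interchange Pₓ P₂ P₄ _ _ _ ⟩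
    (prod Q x (suc M) ⋆ prod Q (x * q²) (suc M)) ⋆ prod Q (x * pow q 4) (suc M)  ∎
    where
    Pₓ = prod Q x M
    P₂ = prod Q (x * q²) M
    P₄ = prod Q (x * pow q 4) M
    3+3M : ∀ M → 3 ℕ.* suc M ≡ suc (suc (suc (3 ℕ.* M)))
    3+3M = solve-∀
    interchange : ∀ a b c x y z → ((((a ⋆ b) ⋆ c) ⋆ x) ⋆ y) ⋆ z ≋ ((a ⋆ x) ⋆ (b ⋆ y)) ⋆ (c ⋆ z)
    interchange = solve 6 (λ a b c x y z → ((((a ⊛ b) ⊛ c) ⊛ x) ⊛ y) ⊛ z ⊜ ((a ⊛ x) ⊛ (b ⊛ y)) ⊛ (c ⊛ z)) ≋-refl
    e₀ : x * pow q² (3 ℕ.* M) ≈ x * pow Q M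
    e₀ = *-congˡ (q²^3M≈Q^M M)
    e₁ : x * (q² * pow q² (3 ℕ.* M)) ≈ (x * q²) * pow Q M
    e₁ = trans (*-congˡ (*-congˡ (q²^3M≈Q^M M))) (sym (*-assoc _ _ _))
    e₂ : x * (q² * (q² * pow q² (3 ℕ.* M))) ≈ (x * pow q 4) * pow Q M
    e₂ = trans (*-congˡ (trans (sym (*-assoc _ _ _)) (*-cong (sym (pow-+ q 2 2)) (q²^3M≈Q^M M)))) (sym (*-assoc _ _ _))

  xσ : Sign → Carrier
  xσ Sign.+ = 1#
  xσ Sign.- = q²

  yσ : Sign → Carrier
  yσ Sign.+ = 1#
  yσ Sign.- = Q

  B : Sign → ℕ → Seq
  B σ M = prod q² (xσ σ) (3 ℕ.* M)

  A : Sign → ℕ → Seq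
  A σ M = prod Q (yσ σ) M

  B-factors : ∀ σ M → B σ M ≋ A σ M ⋆ (prod Q (pow q 4) M ⋆ prod Q q² M)
  B-factors Sign.+ M = begin
    prod q² 1# (3 ℕ.* M)                                            ≈⟨ prod-by-residue 1# M ⟩
    (prod Q 1# M ⋆ prod Q (1# * q²) M) ⋆ prod Q (1# * pow q 4) M    ≈⟨ ⋆-cong (⋆-congˡ _ (prod-cong Q M (*-identityˡ q²)))
                                                                                (prod-cong Q M (*-identityˡ _)) ⟩
    (prod Q 1# M ⋆ prod Q q² M) ⋆ prod Q (pow q 4) M                ≈⟨ rotate-out _ _ _ ⟩
    prod Q 1# M ⋆ (prod Q (pow q 4) M ⋆ prod Q q² M)                ∎
    where
    rotate-out : ∀ f g h → (f ⋆ g) ⋆ h ≋ f ⋆ (h ⋆ g)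
    rotate-out = solve 3 (λ f g h → (f ⊛ g) ⊛ h ⊜ f ⊛ (h ⊛ g)) ≋-refl
  B-factors Sign.- M = begin
    prod q² q² (3 ℕ.* M)                                            ≈⟨ prod-by-residue q² M ⟩
    (prod Q q² M ⋆ prod Q (q² * q²) M) ⋆ prod Q (q² * pow q 4) M    ≈⟨ ⋆-cong (⋆-congˡ _ (prod-cong Q M (sym (pow-+ q 2 2))))
                                                                                (prod-cong Q M (sym (pow-+ q 2 4))) ⟩
    (prod Q q² M ⋆ prod Q (pow q 4) M) ⋆ prod Q Q M                 ≈⟨ rotate-in _ _ _ ⟩
    prod Q Q M ⋆ (prod Q (pow q 4) M ⋆ prod Q q² M)                 ∎
    where
    rotate-in : ∀ f g h → (f ⋆ g) ⋆ h ≋ h ⋆ (g ⋆ f)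
    rotate-in = solve 3 (λ f g h → (f ⊛ g) ⊛ h ⊜ h ⊛ (g ⊛ f)) ≋-refl

  generating-identity : ∀ σ M → B σ M ⋆ prod²⁻¹ Q (M ℕ.+ M) ≋ A σ M ⋆ S M M
  generating-identity σ M = begin
    B σ M ⋆ E                                   ≈⟨ ⋆-congʳ E (B-factors σ M) ⟩
    (A σ M ⋆ (P₄ ⋆ P₂)) ⋆ E                     ≈⟨ ⋆-assoc _ _ _ ⟩
    A σ M ⋆ ((P₄ ⋆ P₂) ⋆ E)                     ≈⟨ ⋆-congˡ (A σ M) (⋆-congʳ E (S-product M M)) ⟨
    A σ M ⋆ ((prod² Q (suc (M ℕ.+ M)) ⋆ S M M) ⋆ E)
                                                ≈⟨ ⋆-congˡ (A σ M) (regroup _ _ _) ⟩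
    A σ M ⋆ (S M M ⋆ (prod² Q (suc (M ℕ.+ M)) ⋆ E))
                                                ≈⟨ ⋆-congˡ (A σ M) (⋆-congˡ (S M M) (prod²-inverse Q (M ℕ.+ M))) ⟩
    A σ M ⋆ (S M M ⋆ δ)                         ≈⟨ ⋆-congˡ (A σ M) (⋆-identityʳ (S M M)) ⟩
    A σ M ⋆ S M M                               ∎
    where
    E = prod²⁻¹ Q (M ℕ.+ M)
    P₄ = prod Q (pow q 4) M
    P₂ = prod Q q² M
    regroup : ∀ f g h → (f ⋆ g) ⋆ h ≋ g ⋆ (f ⋆ h)
    regroup = solve 3 (λ f g h → (f ⊛ g) ⊛ h ⊜ g ⊛ (f ⊛ h)) ≋-refl

-- Step 4: the left-hand side is the z^L coefficient of B / (z²; Q)_(2M+1);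
-- after expanding T and exchanging the sums over j and n, the truncated
-- right-hand side is the z^L coefficient of A · S M M.
module Coefficients {c ℓ : Level} (R : CommutativeRing c ℓ) (q : CommutativeRing.Carrier R) where
  open CommutativeRing R hiding (zero)
  open Series R
  open Basics R
  open FormalSeries R
  open QProducts R
  open DoubleSeries R q
  open ProductFormulas R q
  open Arithmetic
  open import Relation.Binary.Reasoning.Setoid setoid
  open import Algebra.Properties.CommutativeSemigroup *-commutativeSemigroup using (x∙yz≈y∙xz)
  open import Data.Nat.Combinatorics using (_C_)

  if-≡ : ∀ {b b'} {x y : Carrier} → b ≡ b' → (if b then x else y) ≈ (if b' then x else y)
  if-≡ e = reflexive (≡.cong (λ b → if b then _ else _) e)

  if-zero : ∀ b {x} → x ≈ 0# → (if b then x else 0#) ≈ 0#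
  if-zero true  e = e
  if-zero false e = refl

  if-even : ∀ d X (f : ℕ → Carrier) → (if (d % 2 ℕ.≡ᵇ 0) then X * f (d / 2) else 0#) ≈ X * even f d
  if-even d X f with even-or-odd d
  ... | inj₁ (k , ≡.refl) = begin
    (if (k ℕ.* 2) % 2 ℕ.≡ᵇ 0 then X * f ((k ℕ.* 2) / 2) else 0#)  ≈⟨ if-≡ (even-test k) ⟩
    X * f ((k ℕ.* 2) / 2)                                          ≡⟨ ≡.cong (λ i → X * f i) (m*n/n≡m k 2) ⟩
    X * f k                                                        ≈⟨ *-congˡ (even-at-even f k) ⟨
    X * even f (k ℕ.* 2)                                           ∎
  ... | inj₂ (k , ≡.refl) = begin
    (if suc (k ℕ.* 2) % 2 ℕ.≡ᵇ 0 then _ else 0#)  ≈⟨ if-≡ (odd-test k) ⟩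
    0#                                            ≈⟨ zeroʳ X ⟨
    X * 0#                                        ≈⟨ *-congˡ (even-at-odd f k) ⟨
    X * even f (suc (k ℕ.* 2))                    ∎

  if-brackHalf⁺ : ∀ {z} d X N → z ≡ + d →
                  (if evenℤ z then X * brackHalf Q N z else 0#) ≈ X * even (λ k → brack Q N (+ k)) d
  if-brackHalf⁺ d X N ≡.refl = if-even d X (λ k → brack Q N (+ k))

  if-brackHalf⁻ : ∀ {z k} X N → z ≡ -[1+ k ] → (if evenℤ z then X * brackHalf Q N z else 0#) ≈ 0#
  if-brackHalf⁻ X N ≡.refl = if-zero _ (zeroʳ X)

  B-coefficient : ∀ σ M m → B σ M m ≈ pow q (lExp σ m) * gauss q² (3 ℕ.* M) m
  B-coefficient σ M m = trans (q-binomial q² (xσ σ) (3 ℕ.* M) m) (*-congʳ (prefactor σ))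
    where
    prefactor : ∀ σ → pow q² (tri m) * pow (xσ σ) m ≈ pow q (lExp σ m)
    prefactor Sign.+ = begin
      pow q² (tri m) * pow 1# m   ≈⟨ *-cong (sym (pow-* q 2 (tri m))) (pow-1# m) ⟩
      pow q (2 ℕ.* tri m) * 1#    ≈⟨ *-identityʳ _ ⟩
      pow q (2 ℕ.* tri m)         ≡⟨ ≡.cong (pow q) (lExp⁺≡ m) ⟩
      pow q (m ℕ.* m ∸ m)         ∎
    prefactor Sign.- = begin
      pow q² (tri m) * pow q² m               ≈⟨ *-cong (sym (pow-* q 2 (tri m))) (sym (pow-* q 2 m)) ⟩
      pow q (2 ℕ.* tri m) * pow q (2 ℕ.* m)   ≈⟨ pow-+ q (2 ℕ.* tri m) (2 ℕ.* m) ⟨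
      pow q (2 ℕ.* tri m ℕ.+ 2 ℕ.* m)         ≡⟨ ≡.cong (pow q) (lExp⁻≡ m) ⟩
      pow q (m ℕ.* m ℕ.+ m)                   ∎

  LHS-coefficient : ∀ σ L M → LHS σ L M q ≈ (B σ M ⋆ prod²⁻¹ Q (M ℕ.+ M)) L
  LHS-coefficient σ L M = sym (begin
    (B σ M ⋆ prod²⁻¹ Q (M ℕ.+ M)) L                            ≈⟨ diag-sum _ L ⟩
    sumTo (suc L) (λ m → B σ M m * prod²⁻¹ Q (M ℕ.+ M) (L ∸ m)) ≈⟨ sum-cong< (suc L) term ⟩
    sumTo (suc L) F                                            ≈⟨ sum-resize (suc L) (suc (3 ℕ.* M)) F vanishL van3M ⟩
    sumTo (suc (3 ℕ.* M)) F                                    ∎)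
    where
    X : ℕ → Carrier
    X m = pow q (lExp σ m) * gauss q² (3 ℕ.* M) m
    F : ℕ → Carrier
    F m = if evenℤ ((+ L) ℤ.- (+ m)) then X m * brackHalf Q (+ (2 ℕ.* M)) ((+ L) ℤ.- (+ m)) else 0#
    van3M : ∀ m → suc (3 ℕ.* M) ≤ m → F m ≈ 0#
    van3M m 3M<m = if-zero _ (trans (*-congʳ (trans (*-congˡ (gauss-> q² _ m 3M<m)) (zeroʳ _))) (zeroˡ _))
    vanishL : ∀ m → suc L ≤ m → F m ≈ 0#
    vanishL m L<m with ⊖-neg L<m
    ... | _ , e = if-brackHalf⁻ (X m) _ (≡.trans (ℤP.m-n≡m⊖n L m) e)
    binomial : ∀ k → gauss Q (M ℕ.+ M ℕ.+ k) k ≈ brack Q (+ (2 ℕ.* M)) (+ k)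
    binomial k = trans (gauss-sym Q _ k (2 ℕ.* M) (swap M k)) (reflexive (≡.cong (λ n → gauss Q n (2 ℕ.* M)) (double M k)))
      where
      swap : ∀ M k → M ℕ.+ M ℕ.+ k ≡ k ℕ.+ 2 ℕ.* M
      swap = solve-∀
      double : ∀ M k → M ℕ.+ M ℕ.+ k ≡ 2 ℕ.* M ℕ.+ k
      double = solve-∀
    term : ∀ m → m < suc L → B σ M m * prod²⁻¹ Q (M ℕ.+ M) (L ∸ m) ≈ F m
    term m m≤L = sym (begin
      F m                                                 ≈⟨ if-brackHalf⁺ (L ∸ m) (X m) _
                                                               (≡.trans (ℤP.m-n≡m⊖n L m) (ℤP.⊖-≥ (ℕP.≤-pred m≤L))) ⟩
      X m * even (λ k → brack Q (+ (2 ℕ.* M)) (+ k)) (L ∸ m)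
        ≈⟨ *-cong (sym (B-coefficient σ M m)) (even-cong (λ k → sym (binomial k)) (L ∸ m)) ⟩
      B σ M m * prod²⁻¹ Q (M ℕ.+ M) (L ∸ m)               ∎)

  bilateral : ℕ → (ℤ → Carrier) → Carrier
  bilateral K h = sumTo (suc (2 ℕ.* K)) (λ i → h ((+ i) ℤ.- (+ K)))

  bilateral-step : ∀ K h → h -[1+ K ] ≈ 0# → h (+ suc K) ≈ 0# → bilateral (suc K) h ≈ bilateral K h
  bilateral-step K h h₋ h₊ = begin
    bilateral (suc K) h                           ≡⟨ ≡.cong (λ N → sumTo (suc N) f) (two-more K) ⟩
    sumTo (suc (suc (suc (2 ℕ.* K)))) f           ≈⟨ +-congʳ (sum-first (suc (2 ℕ.* K)) f) ⟩
    (f 0 + sumTo (suc (2 ℕ.* K)) (λ i → f (suc i))) + f (suc (suc (2 ℕ.* K)))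
      ≈⟨ +-cong (+-cong h₋ (sum-cong (suc (2 ℕ.* K)) (λ i → reflexive (≡.cong h (diff-suc K i)))))
                (trans (reflexive (≡.cong h top)) h₊) ⟩
    (0# + bilateral K h) + 0#                     ≈⟨ trans (+-identityʳ _) (+-identityˡ _) ⟩
    bilateral K h                                 ∎
    where
    f = λ i → h ((+ i) ℤ.- (+ suc K))
    two-more : ∀ K → 2 ℕ.* suc K ≡ suc (suc (2 ℕ.* K))
    two-more = solve-∀
    double : ∀ K → suc (suc (2 ℕ.* K)) ≡ suc K ℕ.+ suc K
    double = solve-∀
    cancel : ∀ x → (x ℤ.+ x) ℤ.- x ≡ x
    cancel = ℤSolver.solve-∀
    top : (+ suc (suc (2 ℕ.* K))) ℤ.- (+ suc K) ≡ + suc K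
    top = ≡.trans (≡.cong (λ n → (+ n) ℤ.- (+ suc K)) (double K))
            (≡.trans (≡.cong (ℤ._- (+ suc K)) (ℤP.pos-+ (suc K) (suc K))) (cancel (+ suc K)))

  bilateral-shrink : ∀ d e h → (∀ k → d < k → h (+ k) ≈ 0#) → (∀ k → d ≤ k → h -[1+ k ] ≈ 0#) →
                     bilateral (d ℕ.+ e) h ≈ bilateral d h
  bilateral-shrink d zero    h h₊ h₋ = reflexive (≡.cong (λ K → bilateral K h) (ℕP.+-identityʳ d))
  bilateral-shrink d (suc e) h h₊ h₋ = begin
    bilateral (d ℕ.+ suc e) h   ≡⟨ ≡.cong (λ K → bilateral K h) (ℕP.+-suc d e) ⟩
    bilateral (suc (d ℕ.+ e)) h ≈⟨ bilateral-step (d ℕ.+ e) h (h₋ _ (ℕP.m≤m+n d e)) (h₊ _ (s≤s (ℕP.m≤m+n d e))) ⟩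
    bilateral (d ℕ.+ e) h       ≈⟨ bilateral-shrink d e h h₊ h₋ ⟩
    bilateral d h               ∎

  bilateral-reverse : ∀ d h → bilateral d h ≈ sumTo (suc (2 ℕ.* d)) (λ i → h ((+ d) ℤ.- (+ i)))
  bilateral-reverse d h = trans (sum-reverse (suc (2 ℕ.* d)) _)
    (sum-cong< (suc (2 ℕ.* d)) (λ i i< → reflexive (≡.cong h (mirror d i (ℕP.≤-pred i<)))))

  bilateral-even : ∀ d K h → d ≤ K → (∀ k → d < k → h (+ k) ≈ 0#) → (∀ k → d ≤ k → h -[1+ k ] ≈ 0#) →
                   (∀ a → h ((+ d) ℤ.- (+ suc (a ℕ.* 2))) ≈ 0#) →
                   bilateral K h ≈ sumTo (suc d) (λ a → h ((+ d) ℤ.- (+ (a ℕ.* 2))))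
  bilateral-even d K h d≤K h₊ h₋ h-odd = begin
    bilateral K h                             ≡⟨ ≡.cong (λ K → bilateral K h) (≡.sym (ℕP.m+[n∸m]≡n d≤K)) ⟩
    bilateral (d ℕ.+ (K ∸ d)) h               ≈⟨ bilateral-shrink d (K ∸ d) h h₊ h₋ ⟩
    bilateral d h                             ≈⟨ bilateral-reverse d h ⟩
    sumTo (suc (2 ℕ.* d)) g                   ≡⟨ ≡.cong (λ N → sumTo (suc N) g) (ℕP.*-comm 2 d) ⟩
    sumTo (suc (d ℕ.* 2)) g                   ≈⟨ sum-even-odd d g ⟩
    sumTo (suc d) (λ a → g (a ℕ.* 2)) + sumTo d (λ a → g (suc (a ℕ.* 2)))
                                              ≈⟨ +-congˡ (sum-zero d (λ a _ → h-odd a)) ⟩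
    sumTo (suc d) (λ a → g (a ℕ.* 2)) + 0#    ≈⟨ +-identityʳ _ ⟩
    sumTo (suc d) (λ a → g (a ℕ.* 2))         ∎
    where g = λ i → h ((+ d) ℤ.- (+ i))

  w : ℤ → Carrier
  w j = pow q ℤ.∣ (+ 3) ℤ.* j ℤ.* j ℤ.+ j ∣

  -- The pair of half-integer binomials in T, guarded by T's parity test.
  Φ : ℤ → ℤ → ℤ → ℤ → Carrier
  Φ N₁ N₂ z₁ z₂ = if evenℤ z₁ then brackHalf Q N₁ z₁ * brackHalf Q N₂ z₂ else 0#

  Φ-neg₁ : ∀ {z₁ k} N₁ N₂ z₂ → z₁ ≡ -[1+ k ] → Φ N₁ N₂ z₁ z₂ ≈ 0#
  Φ-neg₁ N₁ N₂ z₂ ≡.refl = if-zero _ (zeroˡ _)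

  Φ-neg₂ : ∀ {z₂ k} N₁ N₂ z₁ → z₂ ≡ -[1+ k ] → Φ N₁ N₂ z₁ z₂ ≈ 0#
  Φ-neg₂ N₁ N₂ z₁ ≡.refl = if-zero _ (zeroʳ _)

  Φ-odd : ∀ {z₁} a N₁ N₂ z₂ → z₁ ≡ + suc (a ℕ.* 2) → Φ N₁ N₂ z₁ z₂ ≈ 0#
  Φ-odd a N₁ N₂ z₂ ≡.refl = if-≡ (odd-test a)

  Φ-even : ∀ {z₁ z₂} N₁ N₂ a b → z₁ ≡ + (a ℕ.* 2) → z₂ ≡ + (b ℕ.* 2) →
           Φ N₁ N₂ z₁ z₂ ≈ brack Q N₁ (+ a) * brack Q N₂ (+ b)
  Φ-even N₁ N₂ a b ≡.refl ≡.refl = trans (if-≡ (even-test a))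
    (reflexive (≡.cong₂ (λ x y → brack Q N₁ (+ x) * brack Q N₂ (+ y)) (m*n/n≡m a 2) (m*n/n≡m b 2)))

  brack-⊖ : ∀ {N} u a → N ≡ u ℤ.⊖ a → brack Q N (+ a) ≈ gauss Q u a
  brack-⊖ u a ≡.refl with a ℕ.≤? u
  ... | yes a≤u = begin
    brack Q (u ℤ.⊖ a) (+ a)          ≡⟨ ≡.cong (λ N → brack Q N (+ a)) (ℤP.⊖-≥ a≤u) ⟩
    gauss Q ((u ∸ a) ℕ.+ a) (u ∸ a)  ≡⟨ ≡.cong (λ n → gauss Q n (u ∸ a)) (ℕP.m∸n+n≡m a≤u) ⟩
    gauss Q u (u ∸ a)                ≈⟨ gauss-sym Q u (u ∸ a) a (≡.sym (ℕP.m∸n+n≡m a≤u)) ⟩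
    gauss Q u a                      ∎
  ... | no a≰u with ⊖-neg (ℕP.≰⇒> a≰u)
  ...   | k , e = trans (reflexive (≡.cong (λ N → brack Q N (+ a)) e)) (sym (gauss-> Q u a (ℕP.≰⇒> a≰u)))

  -- The j-th term of the inner bilateral sum, for L - n = d.
  summand : ℕ → ℕ → ℤ → Carrier
  summand d M j = w j * Φ ((+ M) ℤ.+ j) ((+ M) ℤ.- j) ((+ d) ℤ.- j) ((+ d) ℤ.+ j)

  summand-vanish⁺ : ∀ d M k → d < k → summand d M (+ k) ≈ 0#
  summand-vanish⁺ d M k d<k with ⊖-neg d<k
  ... | _ , e = trans (*-congˡ (Φ-neg₁ ((+ M) ℤ.+ (+ k)) ((+ M) ℤ.- (+ k)) ((+ d) ℤ.+ (+ k)) (≡.trans (ℤP.m-n≡m⊖n d k) e)))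
                      (zeroʳ _)

  summand-vanish⁻ : ∀ d M k → d ≤ k → summand d M -[1+ k ] ≈ 0#
  summand-vanish⁻ d M k d≤k with ⊖-neg {d} {suc k} (s≤s d≤k)
  ... | _ , e = trans (*-congˡ (Φ-neg₂ ((+ M) ℤ.+ -[1+ k ]) ((+ M) ℤ.- -[1+ k ]) ((+ d) ℤ.- -[1+ k ]) e)) (zeroʳ _)

  summand-odd : ∀ d M a → summand d M ((+ d) ℤ.- (+ suc (a ℕ.* 2))) ≈ 0#
  summand-odd d M a = trans (*-congˡ (Φ-odd a ((+ M) ℤ.+ j) ((+ M) ℤ.- j) ((+ d) ℤ.+ j) (back (+ d) (+ suc (a ℕ.* 2)))))
                              (zeroʳ _)
    where
    j = (+ d) ℤ.- (+ suc (a ℕ.* 2))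
    back : ∀ x y → x ℤ.- (x ℤ.- y) ≡ y
    back = ℤSolver.solve-∀

  summand-at : ∀ M a b → summand (a ℕ.+ b) M ((+ b) ℤ.- (+ a)) ≈ t M M a b
  summand-at M a b = begin
    w j * Φ ((+ M) ℤ.+ j) ((+ M) ℤ.- j) ((+ (a ℕ.+ b)) ℤ.- j) ((+ (a ℕ.+ b)) ℤ.+ j)
      ≈⟨ *-cong (pow-≡ q (ex≡∣3j²+j∣ a b)) (Φ-even _ _ a b z₁ z₂) ⟩
    pow q (ex a b) * (brack Q ((+ M) ℤ.+ j) (+ a) * brack Q ((+ M) ℤ.- j) (+ b))
      ≈⟨ *-congˡ (*-cong (brack-⊖ (M ℕ.+ b) a N₁) (brack-⊖ (M ℕ.+ a) b N₂)) ⟩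
    pow q (ex a b) * (gauss Q (M ℕ.+ b) a * gauss Q (M ℕ.+ a) b)
      ≈⟨ *-assoc _ _ _ ⟨
    t M M a b  ∎
    where
    j = (+ b) ℤ.- (+ a)
    twice : ∀ a → a ℕ.+ a ≡ a ℕ.* 2
    twice = solve-∀
    e₁ : ∀ x y → (x ℤ.+ y) ℤ.- (y ℤ.- x) ≡ x ℤ.+ x
    e₁ = ℤSolver.solve-∀
    e₂ : ∀ x y → (x ℤ.+ y) ℤ.+ (y ℤ.- x) ≡ y ℤ.+ y
    e₂ = ℤSolver.solve-∀
    e₃ : ∀ m x y → m ℤ.+ (y ℤ.- x) ≡ (m ℤ.+ y) ℤ.- x
    e₃ = ℤSolver.solve-∀
    e₄ : ∀ m x y → m ℤ.- (y ℤ.- x) ≡ (m ℤ.+ x) ℤ.- y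
    e₄ = ℤSolver.solve-∀
    z₁ : (+ (a ℕ.+ b)) ℤ.- j ≡ + (a ℕ.* 2)
    z₁ = ≡.trans (e₁ (+ a) (+ b)) (≡.cong +_ (twice a))
    z₂ : (+ (a ℕ.+ b)) ℤ.+ j ≡ + (b ℕ.* 2)
    z₂ = ≡.trans (e₂ (+ a) (+ b)) (≡.cong +_ (twice b))
    N₁ : (+ M) ℤ.+ j ≡ (M ℕ.+ b) ℤ.⊖ a
    N₁ = ≡.trans (e₃ (+ M) (+ a) (+ b)) (ℤP.m-n≡m⊖n (M ℕ.+ b) a)
    N₂ : (+ M) ℤ.- j ≡ (M ℕ.+ a) ℤ.⊖ b
    N₂ = ≡.trans (e₄ (+ M) (+ a) (+ b)) (ℤP.m-n≡m⊖n (M ℕ.+ a) b)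

  summand-even : ∀ d M a → a ≤ d → summand d M ((+ d) ℤ.- (+ (a ℕ.* 2))) ≈ t M M a (d ∸ a)
  summand-even d M a a≤d = trans (reflexive (≡.cong₂ (λ d j → summand d M j) d≡a+b j≡b-a)) (summand-at M a b)
    where
    b = d ∸ a
    d≡a+b : d ≡ a ℕ.+ b
    d≡a+b = ≡.sym (ℕP.m+[n∸m]≡n a≤d)
    twice : ∀ a → a ℕ.* 2 ≡ a ℕ.+ a
    twice = solve-∀
    diff : ∀ x y → (x ℤ.+ y) ℤ.- (x ℤ.+ x) ≡ y ℤ.- x
    diff = ℤSolver.solve-∀
    j≡b-a : (+ d) ℤ.- (+ (a ℕ.* 2)) ≡ (+ b) ℤ.- (+ a)
    j≡b-a = ≡.trans (≡.cong₂ (λ x y → (+ x) ℤ.- (+ y)) d≡a+b (twice a)) (diff (+ a) (+ b))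

  -- The half-binomial part of the (j, n) term of T σ (L, M; j, j; Q).
  Ψ : ℕ → ℕ → ℤ → ℕ → Carrier
  Ψ L M j n = Φ ((+ M) ℤ.+ j) ((+ M) ℤ.- j) ((+ L) ℤ.- j ℤ.- (+ n)) ((+ L) ℤ.+ j ℤ.- (+ n))

  -- After exchanging the sums over j and n: Σ_{|j| ≤ K} q^(3j²+j) Ψ L M j n.
  inner : ℕ → ℕ → ℕ → ℕ → Carrier
  inner L M K n = bilateral K (λ j → w j * Ψ L M j n)

  Ψ-summand : ∀ L M n j → n ≤ L → w j * Ψ L M j n ≡ summand (L ∸ n) M j
  Ψ-summand L M n j n≤L = ≡.cong₂ (λ z₁ z₂ → w j * Φ ((+ M) ℤ.+ j) ((+ M) ℤ.- j) z₁ z₂)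
    (≡.trans (≡.cong (λ x → (+ x) ℤ.- j ℤ.- (+ n)) L≡d+n) (e₁ (+ d) (+ n) j))
    (≡.trans (≡.cong (λ x → (+ x) ℤ.+ j ℤ.- (+ n)) L≡d+n) (e₂ (+ d) (+ n) j))
    where
    d = L ∸ n
    L≡d+n : L ≡ d ℕ.+ n
    L≡d+n = ≡.sym (ℕP.m∸n+n≡m n≤L)
    e₁ : ∀ x y j → (x ℤ.+ y) ℤ.- j ℤ.- y ≡ x ℤ.- j
    e₁ = ℤSolver.solve-∀
    e₂ : ∀ x y j → (x ℤ.+ y) ℤ.+ j ℤ.- y ≡ x ℤ.+ j
    e₂ = ℤSolver.solve-∀

  inner-as-S : ∀ L M K n → L ≤ K → n ≤ L → inner L M K n ≈ S M M (L ∸ n)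
  inner-as-S L M K n L≤K n≤L = begin
    inner L M K n
      ≈⟨ sum-cong (suc (2 ℕ.* K)) (λ i → reflexive (Ψ-summand L M n ((+ i) ℤ.- (+ K)) n≤L)) ⟩
    bilateral K (summand d M)                      ≈⟨ bilateral-even d K (summand d M) (ℕP.≤-trans (ℕP.m∸n≤m L n) L≤K)
                                                        (summand-vanish⁺ d M) (summand-vanish⁻ d M) (summand-odd d M) ⟩
    sumTo (suc d) (λ a → summand d M ((+ d) ℤ.- (+ (a ℕ.* 2))))
                                                   ≈⟨ sum-cong< (suc d) (λ a a≤d → summand-even d M a (ℕP.≤-pred a≤d)) ⟩
    sumTo (suc d) (λ a → t M M a (d ∸ a))          ≈⟨ diag-sum (t M M) d ⟨
    S M M d                                        ∎
    where d = L ∸ n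

  Ψ-vanish : ∀ L M n j → L < n → Ψ L M j n ≈ 0#
  Ψ-vanish L M n j L<n with ⊖-neg L<n
  Ψ-vanish L M n (+ k) L<n | e , L⊖n = Φ-neg₁ _ _ ((+ L) ℤ.+ (+ k) ℤ.- (+ n)) (minus-below-zero k L⊖n)
  Ψ-vanish L M n -[1+ k ] L<n | e , L⊖n = Φ-neg₂ _ _ ((+ L) ℤ.- -[1+ k ] ℤ.- (+ n))
    (≡.trans (reorder (+ L) -[1+ k ] (+ n)) (≡.cong (ℤ._+ -[1+ k ]) (≡.trans (ℤP.m-n≡m⊖n L n) L⊖n)))
    where
    reorder : ∀ x j y → x ℤ.+ j ℤ.- y ≡ (x ℤ.- y) ℤ.+ j
    reorder = ℤSolver.solve-∀

  inner-vanish : ∀ L M K n → L < n → inner L M K n ≈ 0#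
  inner-vanish L M K n L<n =
    sum-zero (suc (2 ℕ.* K)) (λ i _ → trans (*-congˡ (Ψ-vanish L M n ((+ i) ℤ.- (+ K)) L<n)) (zeroʳ _))

  A-coefficient : ∀ σ M n → A σ M n ≈ pow Q (tExp σ n) * gauss Q M n
  A-coefficient Sign.+ M n = trans (q-binomial Q 1# M n) (*-congʳ (begin
    pow Q (tri n) * pow 1# n  ≈⟨ trans (*-congˡ (pow-1# n)) (*-identityʳ _) ⟩
    pow Q (tri n)             ≡⟨ ≡.cong (pow Q) (C2≡tri n) ⟨
    pow Q (n C 2)             ∎))
  A-coefficient Sign.- M n = trans (q-binomial Q Q M n) (*-congʳ (begin
    pow Q (tri n) * pow Q n   ≈⟨ pow-+ Q (tri n) n ⟨
    pow Q (tri (suc n))       ≡⟨ ≡.cong (pow Q) (C2≡tri (suc n)) ⟨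
    pow Q (suc n C 2)         ∎))

  T-term : ∀ σ L M j n →
    (if evenℤ ((+ L) ℤ.- j ℤ.- (+ n))
     then pow Q (tExp σ n) * gauss Q M n * brackHalf Q ((+ M) ℤ.+ j) ((+ L) ℤ.- j ℤ.- (+ n))
          * brackHalf Q ((+ M) ℤ.- j) ((+ L) ℤ.+ j ℤ.- (+ n))
     else 0#) ≈ (pow Q (tExp σ n) * gauss Q M n) * Ψ L M j n
  T-term σ L M j n with evenℤ ((+ L) ℤ.- j ℤ.- (+ n))
  ... | true  = *-assoc _ _ _
  ... | false = sym (zeroʳ _)

  RHS-coefficient : ∀ σ L M K → L ≤ K → RHSpartial σ L M K q ≈ (A σ M ⋆ S M M) L
  RHS-coefficient σ L M K L≤K = begin
    RHSpartial σ L M K q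
      ≈⟨ sum-cong (suc (2 ℕ.* K)) (λ i → trans (sym (sum-*ˡ (suc M) (w (j i)) _))
                                                (sum-cong (suc M) (λ n → *-congˡ (T-term σ L M (j i) n)))) ⟩
    sumTo (suc (2 ℕ.* K)) (λ i → sumTo (suc M) (λ n → w (j i) * (α n * Ψ L M (j i) n)))
      ≈⟨ sum-swap (suc (2 ℕ.* K)) (suc M) _ ⟩
    sumTo (suc M) (λ n → sumTo (suc (2 ℕ.* K)) (λ i → w (j i) * (α n * Ψ L M (j i) n)))
      ≈⟨ sum-cong (suc M) (λ n → trans (sum-cong (suc (2 ℕ.* K)) (λ i → x∙yz≈y∙xz _ _ _))
                                      (sum-*ˡ (suc (2 ℕ.* K)) (α n) _)) ⟩
    sumTo (suc M) H
      ≈⟨ sum-resize (suc M) (suc L) H vanishM vanishL ⟩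
    sumTo (suc L) H
      ≈⟨ sum-cong< (suc L) (λ n n≤L → *-cong (sym (A-coefficient σ M n)) (inner-as-S L M K n L≤K (ℕP.≤-pred n≤L))) ⟩
    sumTo (suc L) (λ n → A σ M n * S M M (L ∸ n))
      ≈⟨ diag-sum _ L ⟨
    (A σ M ⋆ S M M) L  ∎
    where
    j : ℕ → ℤ
    j i = (+ i) ℤ.- (+ K)
    α : ℕ → Carrier
    α n = pow Q (tExp σ n) * gauss Q M n
    H : ℕ → Carrier
    H n = α n * inner L M K n
    vanishM : ∀ n → suc M ≤ n → H n ≈ 0#
    vanishM n M<n = trans (*-congʳ (trans (*-congˡ (gauss-> Q M n M<n)) (zeroʳ _))) (zeroˡ _)
    vanishL : ∀ n → suc L ≤ n → H n ≈ 0#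
    vanishL n L<n = trans (*-congˡ (inner-vanish L M K n L<n)) (zeroʳ _)

theorem7p1 : {c ℓ : Level} (R : CommutativeRing c ℓ) (q : CommutativeRing.Carrier R)
    (σ : Sign) (L M K : ℕ) → L ≤ K →
    CommutativeRing._≈_ R (Series.LHS R σ L M q) (Series.RHSpartial R σ L M K q)
theorem7p1 R q σ L M K L≤K = begin
  LHS σ L M q                          ≈⟨ LHS-coefficient σ L M ⟩
  (B σ M ⋆ prod²⁻¹ Q (M ℕ.+ M)) L      ≈⟨ generating-identity σ M L ⟩
  (A σ M ⋆ S M M) L                    ≈⟨ RHS-coefficient σ L M K L≤K ⟨
  RHSpartial σ L M K q                 ∎
  where
  open CommutativeRing R using (setoid)
  open Series R using (LHS; RHSpartial)
  open FormalSeries R using (_⋆_)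
  open QProducts R using (prod²⁻¹)
  open DoubleSeries R q using (Q; S)
  open ProductFormulas R q using (A; B; generating-identity)
  open Coefficients R q using (LHS-coefficient; RHS-coefficient)
  open import Relation.Binary.Reasoning.Setoid setoid
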